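{- For a positive integer $k$, let $A_k(n)$ be defined by $$\sum_{n=0}^{\infty}A_k(n)q^n=\frac{1}{(-q;q)_\infty(-q^k;q^k)_\infty}=(q;q^2)_\infty(q^k;q^{2k})_\infty,$$ equivalently $A_k(n)=a_e^k(n)-a_o^k(n)$, where $a_e^k(n)$ (resp. $a_o^k(n)$) is the number of partitions of $n$ into an even (resp. odd) number of parts in which the parts that are multiples of $k$ may appear in two colours. Then for all $n\ge0$, $$A_3(4n+2)\equiv 0\pmod 2\quad\text{and}\quad A_3(4n+3)\equiv 0\pmod 2.$$
   Context: $(a;q)_\infty=\prod_{j\ge0}(1-aq^j)$ for $|q|<1$. -}

module Defs where

open import Data.Nat using (ℕ; zero; suc; _∸_; _≤ᵇ_) renaming (_+_ to _+ℕ_; _*_ to _*ℕ_)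
open import Data.Integer using (ℤ; _-_; 0ℤ; 1ℤ)
open import Data.List using (List; map; upTo; foldr; _++_)
open import Data.Bool using (if_then_else_)

-- Formal power series in q with integer coefficients: i ↦ coefficient of q^i.
Series : Set
Series = ℕ → ℤ

one : Series
one zero    = 1ℤ
one (suc _) = 0ℤ

times1- : ℕ → Series → Series
times1- m f i = f i - (if m ≤ᵇ i then f (i ∸ m) else 0ℤ)

prodFactors : List ℕ → Series
prodFactors ms = foldr times1- one ms

-- odd numbers 1, 3, ..., 2n-1 (all odd numbers ≤ n, and more)
odds : ℕ → List ℕ
odds n = map (λ j → 2 *ℕ j +ℕ 1) (upTo n)

-- Truncation of (q;q^2)_∞ (q^k;q^{2k})_∞ : all factors (1 - q^m) with m ≤ n are
-- included (factors with m > n do not affect the coefficient of q^n).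
truncProd : ℕ → ℕ → Series
truncProd k n = prodFactors (odds n ++ map (k *ℕ_) (odds n))

A : ℕ → ℕ → ℤ
A k n = truncProd k n n

-- Modulo 2 every factor 1 - q^m becomes 1 + q^m, so A₃(n) is the coefficient of q^n in O(q) O(q³)
-- over 𝔽₂, where O = ∏_{n ≥ 0} (1 + q^{2n+1}).  Put E = ∏_{n ≥ 1} (1 + q^n) and ψ = Σ_{a ≥ 0} q^{a(a+1)/2}.
-- Splitting the factors of E into odd and even ones gives E = O · E(q²); since squaring over 𝔽₂ is
-- q ↦ q², this says O E = 1.  Gauss's identity E² = ψ O, proved with the involutions behind the
-- Jacobi triple product, then gives ψ O³ = 1, whence
--   O(q) O(q³) = O(q⁴) O(q¹²) · ψ(q) ψ(q³).
-- Hence the coefficients of O(q) O(q³) at 4n + 2 and 4n + 3 are sums of coefficients of ψ(q) ψ(q³) in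
-- the same residue classes.  Those count the pairs (a , b) with T_a + 3 T_b = N, where T_a = a(a+1)/2,
-- and a unit of the Eisenstein integers pairs them off, its fixed points having T_a + 3 T_b ≡ 0 or 1 (mod 4).

module Submission where

open import Algebra.Bundles using (CommutativeMonoid)
import Algebra.Solver.CommutativeMonoid as CommutativeMonoidSolver
open import Data.Bool using (Bool; true; false; _xor_; _∧_; not; if_then_else_)
open import Data.Bool.Properties
  using (xor-assoc; xor-comm; xor-same; xor-identityˡ; xor-identityʳ;
         ∧-comm; ∧-assoc; ∧-idem; ∧-zeroʳ; ∧-identityʳ; ∧-distribˡ-xor; not-involutive)
import Data.Bool.Properties as Boolₚ
open import Data.List using (List; []; _∷_; _++_; map; foldr; upTo; applyUpTo; cartesianProduct)
open import Data.List.Membership.Propositional using (_∈_)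
open import Data.List.Membership.Propositional.Properties
  using (∈-cartesianProduct⁺; ∈-upTo⁺; ∈-++⁺ˡ; ∈-++⁺ʳ; ∈-map⁺; ∈-map⁻)
open import Data.List.Properties using (map-++; map-∘; map-cong; map-applyUpTo; upTo-∷ʳ; ++-identityʳ)
open import Data.List.Relation.Binary.Disjoint.Propositional using (Disjoint)
open import Data.List.Relation.Unary.All as All using (All; []; _∷_)
import Data.List.Relation.Unary.All.Properties as Allₚ
open import Data.List.Relation.Unary.AllPairs using ([]; _∷_)
open import Data.List.Relation.Unary.Any using (here; there)
open import Data.List.Relation.Unary.Unique.Propositional using (Unique)
import Data.List.Relation.Unary.Unique.Propositional.Properties as Uniqueₚ
open import Data.Nat
  using (ℕ; zero; suc; pred; _+_; _*_; _∸_; _≤_; _<_; z≤n; s≤s; _≡ᵇ_; _≤ᵇ_; _<ᵇ_; _≟_; _≤?_;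
         ⌊_/2⌋; ∣_-_∣; NonZero; >-nonZero)
open import Data.Nat.DivMod using (_%_; [m+kn]%n≡m%n; m*n%n≡0; m<n⇒m%n≡m)
open import Data.Nat.Divisibility
  using (divides; divides-refl; _∣?_; ∣m+n∣m⇒∣n; n∣m*n; ∣m∣n⇒∣m+n; ∣⇒≤) renaming (_∣_ to _∣ℕ_)
open import Data.Nat.Properties
open import Data.Nat.Tactic.RingSolver using (solve-∀)
open import Data.Product using (_×_; _,_; proj₁; proj₂; ∃)
open import Data.Product.Properties using (≡-dec)
open import Data.Sum using (_⊎_; inj₁; inj₂)
open import Data.Vec using (Vec; []; _∷_; _∷ʳ_; init; last; initLast)
open import Data.Vec.Properties using (∷-injectiveʳ; init-∷ʳ; last-∷ʳ)
import Data.Vec.Properties as Vecₚ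
open import Function using (_∘_; id)
open import Relation.Binary.Bundles using (Setoid)
open import Relation.Binary.Definitions using (DecidableEquality)
open import Relation.Binary.PropositionalEquality
import Relation.Binary.Reasoning.Setoid as SetoidReasoning
open import Relation.Nullary using (¬_; yes; no; does)
open import Relation.Nullary.Decidable using (dec-true; dec-false)
open import Relation.Nullary.Negation using (contradiction)

open import Defs using (odds; prodFactors; A)

∧-true : ∀ {a b} → a ∧ b ≡ true → a ≡ true × b ≡ true
∧-true {true} {true} _ = refl , refl

≡ᵇ-true : ∀ {m n} → m ≡ n → (m ≡ᵇ n) ≡ true
≡ᵇ-true {zero}  refl = refl
≡ᵇ-true {suc m} refl = ≡ᵇ-true {m} refl

≡ᵇ-false : ∀ {m n} → m ≢ n → (m ≡ᵇ n) ≡ false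
≡ᵇ-false {zero}  {zero}  m≢n = contradiction refl m≢n
≡ᵇ-false {zero}  {suc n} _   = refl
≡ᵇ-false {suc m} {zero}  _   = refl
≡ᵇ-false {suc m} {suc n} m≢n = ≡ᵇ-false (m≢n ∘ cong suc)

≡ᵇ-true⇒≡ : ∀ {m n} → (m ≡ᵇ n) ≡ true → m ≡ n
≡ᵇ-true⇒≡ {zero}  {zero}  _ = refl
≡ᵇ-true⇒≡ {suc m} {suc n} p = cong suc (≡ᵇ-true⇒≡ p)

≡ᵇ-comm : ∀ m n → (m ≡ᵇ n) ≡ (n ≡ᵇ m)
≡ᵇ-comm zero    zero    = refl
≡ᵇ-comm zero    (suc n) = refl
≡ᵇ-comm (suc m) zero    = refl
≡ᵇ-comm (suc m) (suc n) = ≡ᵇ-comm m n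

≤ᵇ-true : ∀ {m n} → m ≤ n → (m ≤ᵇ n) ≡ true
≤ᵇ-true {zero}                 _         = refl
≤ᵇ-true {suc zero}    {suc n}  _         = refl
≤ᵇ-true {suc (suc m)} {suc n}  (s≤s m≤n) = ≤ᵇ-true m≤n

≤ᵇ-false : ∀ {m n} → n < m → (m ≤ᵇ n) ≡ false
≤ᵇ-false {suc zero}    {zero}  _          = refl
≤ᵇ-false {suc (suc m)} {zero}  _          = refl
≤ᵇ-false {suc zero}    {suc n} (s≤s ())
≤ᵇ-false {suc (suc m)} {suc n} (s≤s n<m) = ≤ᵇ-false n<m

<ᵇ-suc : ∀ m n → (m <ᵇ suc n) ≡ (m ≤ᵇ n)
<ᵇ-suc zero    n = refl
<ᵇ-suc (suc m) n = refl

≤ᵇ-∧-≡ᵇ : ∀ m n i → (m ≤ᵇ i) ∧ (n ≡ᵇ i ∸ m) ≡ (m + n ≡ᵇ i)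
≤ᵇ-∧-≡ᵇ zero    n i       = refl
≤ᵇ-∧-≡ᵇ (suc m) n zero    = refl
≤ᵇ-∧-≡ᵇ (suc m) n (suc i) = trans (cong (_∧ (n ≡ᵇ i ∸ m)) (<ᵇ-suc m i)) (≤ᵇ-∧-≡ᵇ m n i)

≤ᵇ-∧-≤ᵇ : ∀ m n i → (m ≤ᵇ i) ∧ (n ≤ᵇ i ∸ m) ≡ (m + n ≤ᵇ i)
≤ᵇ-∧-≤ᵇ zero    n i       = refl
≤ᵇ-∧-≤ᵇ (suc m) n zero    = refl
≤ᵇ-∧-≤ᵇ (suc m) n (suc i) = trans (cong (_∧ (n ≤ᵇ i ∸ m)) (<ᵇ-suc m i))
                                  (trans (≤ᵇ-∧-≤ᵇ m n i) (sym (<ᵇ-suc (m + n) i)))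

xor-interchange : ∀ a b c d → (a xor b) xor (c xor d) ≡ (a xor c) xor (b xor d)
xor-interchange a b c d = begin
  (a xor b) xor (c xor d) ≡⟨ xor-assoc a b _ ⟩
  a xor (b xor (c xor d)) ≡⟨ cong (a xor_) (sym (xor-assoc b c d)) ⟩
  a xor ((b xor c) xor d) ≡⟨ cong (λ x → a xor (x xor d)) (xor-comm b c) ⟩
  a xor ((c xor b) xor d) ≡⟨ cong (a xor_) (xor-assoc c b d) ⟩
  a xor (c xor (b xor d)) ≡⟨ sym (xor-assoc a c _) ⟩
  (a xor c) xor (b xor d) ∎
  where open ≡-Reasoning

xor-cancelʳ : ∀ {a b} c → a xor c ≡ b xor c → a ≡ b
xor-cancelʳ {a} {b} c p = begin
  a                 ≡⟨ sym (xor-identityʳ a) ⟩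
  a xor false       ≡⟨ cong (a xor_) (sym (xor-same c)) ⟩
  a xor (c xor c)   ≡⟨ sym (xor-assoc a c c) ⟩
  (a xor c) xor c   ≡⟨ cong (_xor c) p ⟩
  (b xor c) xor c   ≡⟨ xor-assoc b c c ⟩
  b xor (c xor c)   ≡⟨ cong (b xor_) (xor-same c) ⟩
  b xor false       ≡⟨ xor-identityʳ b ⟩
  b                 ∎
  where open ≡-Reasoning

-- Sums over 𝔽₂ = (Bool, xor, ∧)

sumBelow : ℕ → (ℕ → Bool) → Bool
sumBelow zero    f = false
sumBelow (suc n) f = f 0 xor sumBelow n (f ∘ suc)

syntax sumBelow n (λ i → e) = ⨁[ i < n ] e

⨁<-cong : ∀ n {f g : ℕ → Bool} → (∀ i → i < n → f i ≡ g i) → sumBelow n f ≡ sumBelow n g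
⨁<-cong zero    _   = refl
⨁<-cong (suc n) f≗g = cong₂ _xor_ (f≗g 0 (s≤s z≤n)) (⨁<-cong n (λ i i<n → f≗g (suc i) (s≤s i<n)))

⨁<-false : ∀ n {f} → (∀ i → i < n → f i ≡ false) → sumBelow n f ≡ false
⨁<-false zero    _   = refl
⨁<-false (suc n) f≡0 rewrite f≡0 0 (s≤s z≤n) = ⨁<-false n (λ i i<n → f≡0 (suc i) (s≤s i<n))

⨁<-+ : ∀ m n f → sumBelow (m + n) f ≡ sumBelow m f xor (⨁[ k < n ] f (m + k))
⨁<-+ zero    n f = refl
⨁<-+ (suc m) n f = trans (cong (f 0 xor_) (⨁<-+ m n (f ∘ suc))) (sym (xor-assoc (f 0) _ _))

⨁<-snoc : ∀ n f → sumBelow (suc n) f ≡ sumBelow n f xor f n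
⨁<-snoc n f = begin
  sumBelow (suc n) f               ≡⟨ cong (λ m → sumBelow m f) (+-comm 1 n) ⟩
  sumBelow (n + 1) f               ≡⟨ ⨁<-+ n 1 f ⟩
  sumBelow n f xor (f (n + 0) xor false)
    ≡⟨ cong (λ x → sumBelow n f xor x) (trans (xor-identityʳ _) (cong f (+-identityʳ n))) ⟩
  sumBelow n f xor f n             ∎
  where open ≡-Reasoning

⨁<-xor : ∀ n f g → (⨁[ i < n ] (f i xor g i)) ≡ sumBelow n f xor sumBelow n g
⨁<-xor zero    f g = refl
⨁<-xor (suc n) f g = trans (cong ((f 0 xor g 0) xor_) (⨁<-xor n (f ∘ suc) (g ∘ suc)))
                            (xor-interchange (f 0) (g 0) _ _)

⨁<-∧ˡ : ∀ n a f → a ∧ sumBelow n f ≡ (⨁[ i < n ] (a ∧ f i))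
⨁<-∧ˡ zero    a f = ∧-zeroʳ a
⨁<-∧ˡ (suc n) a f = trans (∧-distribˡ-xor a (f 0) _) (cong ((a ∧ f 0) xor_) (⨁<-∧ˡ n a (f ∘ suc)))

⨁<-∧ʳ : ∀ n a f → sumBelow n f ∧ a ≡ (⨁[ i < n ] (f i ∧ a))
⨁<-∧ʳ n a f = trans (∧-comm (sumBelow n f) a)
                (trans (⨁<-∧ˡ n a f) (⨁<-cong n (λ i _ → ∧-comm a (f i))))

⨁<-swap : ∀ m n (f : ℕ → ℕ → Bool) →
          (⨁[ i < m ] (⨁[ j < n ] f i j)) ≡ (⨁[ j < n ] (⨁[ i < m ] f i j))
⨁<-swap zero    n f = sym (⨁<-false n (λ _ _ → refl))
⨁<-swap (suc m) n f = trans (cong (sumBelow n (f 0) xor_) (⨁<-swap m n (f ∘ suc)))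
                            (sym (⨁<-xor n (f 0) _))

⨁<-reverse : ∀ n f → sumBelow n f ≡ (⨁[ i < n ] f (n ∸ suc i))
⨁<-reverse zero    f = refl
⨁<-reverse (suc n) f = begin
  f 0 xor sumBelow n (f ∘ suc)                     ≡⟨ cong (f 0 xor_) (⨁<-reverse n (f ∘ suc)) ⟩
  f 0 xor (⨁[ i < n ] f (suc (n ∸ suc i)))          ≡⟨ xor-comm (f 0) _ ⟩
  (⨁[ i < n ] f (suc (n ∸ suc i))) xor f 0
    ≡⟨ cong₂ _xor_ (⨁<-cong n (λ i i<n → cong f (sym (+-∸-assoc 1 i<n)))) (cong f (sym (n∸n≡0 n))) ⟩
  (⨁[ i < n ] f (suc n ∸ suc i)) xor f (suc n ∸ suc n) ≡⟨ sym (⨁<-snoc n (λ i → f (suc n ∸ suc i))) ⟩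
  (⨁[ i < suc n ] f (suc n ∸ suc i))                ∎
  where open ≡-Reasoning

⨁<-indicator : ∀ n a (f : ℕ → Bool) → (⨁[ i < n ] ((i ≡ᵇ a) ∧ f i)) ≡ (suc a ≤ᵇ n) ∧ f a
⨁<-indicator zero    a       f = refl
⨁<-indicator (suc n) zero    f = trans (cong (f 0 xor_) (⨁<-false n (λ _ _ → refl))) (xor-identityʳ (f 0))
⨁<-indicator (suc n) (suc a) f = ⨁<-indicator n a (f ∘ suc)

⨁<-extend : ∀ i n (f : ℕ → Bool) → i ≤ n → sumBelow (suc i) f ≡ (⨁[ j < suc n ] ((j ≤ᵇ i) ∧ f j))
⨁<-extend i n f i≤n = begin
  sumBelow (suc i) f
    ≡⟨ sym (⨁<-cong (suc i) (λ j j≤i → cong (_∧ f j) (≤ᵇ-true (≤-pred j≤i)))) ⟩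
  (⨁[ j < suc i ] ((j ≤ᵇ i) ∧ f j))
    ≡⟨ sym (xor-identityʳ _) ⟩
  (⨁[ j < suc i ] ((j ≤ᵇ i) ∧ f j)) xor false
    ≡⟨ cong ((⨁[ j < suc i ] ((j ≤ᵇ i) ∧ f j)) xor_) (sym (⨁<-false (n ∸ i) {λ k → (suc i + k ≤ᵇ i) ∧ f (suc i + k)}
                                      (λ k _ → cong (_∧ f (suc i + k)) (≤ᵇ-false (s≤s (m≤m+n i k)))))) ⟩
  (⨁[ j < suc i ] ((j ≤ᵇ i) ∧ f j)) xor (⨁[ k < n ∸ i ] ((suc i + k ≤ᵇ i) ∧ f (suc i + k)))
    ≡⟨ sym (⨁<-+ (suc i) (n ∸ i) (λ j → (j ≤ᵇ i) ∧ f j)) ⟩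
  (⨁[ j < suc i + (n ∸ i) ] ((j ≤ᵇ i) ∧ f j))
    ≡⟨ cong (λ m → ⨁[ j < suc m ] ((j ≤ᵇ i) ∧ f j)) (m+[n∸m]≡n i≤n) ⟩
  (⨁[ j < suc n ] ((j ≤ᵇ i) ∧ f j)) ∎
  where open ≡-Reasoning

⨁<-shift : ∀ j n (f : ℕ → Bool) → j ≤ n →
           (⨁[ i < suc n ] ((j ≤ᵇ i) ∧ f i)) ≡ (⨁[ k < suc (n ∸ j) ] f (j + k))
⨁<-shift j n f j≤n = begin
  (⨁[ i < suc n ] ((j ≤ᵇ i) ∧ f i))
    ≡⟨ cong (λ m → ⨁[ i < m ] ((j ≤ᵇ i) ∧ f i)) (sym (trans (+-suc j _) (cong suc (m+[n∸m]≡n j≤n)))) ⟩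
  (⨁[ i < j + suc (n ∸ j) ] ((j ≤ᵇ i) ∧ f i))
    ≡⟨ ⨁<-+ j (suc (n ∸ j)) (λ i → (j ≤ᵇ i) ∧ f i) ⟩
  (⨁[ i < j ] ((j ≤ᵇ i) ∧ f i)) xor (⨁[ k < suc (n ∸ j) ] ((j ≤ᵇ j + k) ∧ f (j + k)))
    ≡⟨ cong₂ _xor_ (⨁<-false j (λ i i<j → cong (_∧ f i) (≤ᵇ-false i<j)))
                   (⨁<-cong (suc (n ∸ j)) (λ k _ → cong (_∧ f (j + k)) (≤ᵇ-true (m≤m+n j k)))) ⟩
  (⨁[ k < suc (n ∸ j) ] f (j + k)) ∎
  where open ≡-Reasoning

⨁<-extend-vanishing : ∀ m n f → m ≤ n → (∀ i → m < i → f i ≡ false) →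
                      sumBelow (suc m) f ≡ sumBelow (suc n) f
⨁<-extend-vanishing m n f m≤n f≡0 = begin
  sumBelow (suc m) f                                       ≡⟨ sym (xor-identityʳ _) ⟩
  sumBelow (suc m) f xor false
    ≡⟨ cong (sumBelow (suc m) f xor_) (sym (⨁<-false (n ∸ m) (λ k _ → f≡0 (suc m + k) (s≤s (m≤m+n m k))))) ⟩
  sumBelow (suc m) f xor (⨁[ k < n ∸ m ] f (suc m + k))    ≡⟨ sym (⨁<-+ (suc m) (n ∸ m) f) ⟩
  sumBelow (suc m + (n ∸ m)) f                             ≡⟨ cong (λ k → sumBelow (suc k) f) (m+[n∸m]≡n m≤n) ⟩
  sumBelow (suc n) f                                       ∎
  where open ≡-Reasoning

⨁<-telescope : ∀ M (g : ℕ → Bool) → (⨁[ m < M ] (g m xor g (suc m))) ≡ g 0 xor g M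
⨁<-telescope zero    g = sym (xor-same (g 0))
⨁<-telescope (suc M) g = begin
  (g 0 xor g 1) xor (⨁[ m < M ] (g (suc m) xor g (suc (suc m)))) ≡⟨ cong ((g 0 xor g 1) xor_) (⨁<-telescope M (g ∘ suc)) ⟩
  (g 0 xor g 1) xor (g 1 xor g (suc M))                             ≡⟨ xor-assoc (g 0) (g 1) _ ⟩
  g 0 xor (g 1 xor (g 1 xor g (suc M)))                             ≡⟨ cong (g 0 xor_) (sym (xor-assoc (g 1) (g 1) _)) ⟩
  g 0 xor ((g 1 xor g 1) xor g (suc M))                             ≡⟨ cong (λ b → g 0 xor (b xor g (suc M))) (xor-same (g 1)) ⟩
  g 0 xor g (suc M)                                                 ∎
  where open ≡-Reasoning

-- the central term of a sum over i ≤ n (none when n is odd)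
centre : ℕ → (ℕ → Bool) → Bool
centre zero          F = F 0
centre (suc zero)    F = false
centre (suc (suc n)) F = centre n (F ∘ suc)

centre-even : ∀ m F → centre (m * 2) F ≡ F m
centre-even zero    F = refl
centre-even (suc m) F = centre-even m (F ∘ suc)

centre-odd : ∀ m F → centre (suc (m * 2)) F ≡ false
centre-odd zero    F = refl
centre-odd (suc m) F = centre-odd m (F ∘ suc)

⨁<-palindrome : ∀ n F → (∀ i → i ≤ n → F i ≡ F (n ∸ i)) → (⨁[ i < suc n ] F i) ≡ centre n F
⨁<-palindrome zero          F _   = xor-identityʳ (F 0)
⨁<-palindrome (suc zero)    F F-sym rewrite F-sym 0 z≤n = trans (cong (F 1 xor_) (xor-identityʳ (F 1))) (xor-same (F 1))
⨁<-palindrome (suc (suc n)) F F-sym = begin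
  F 0 xor (⨁[ i < suc (suc n) ] F (suc i))
    ≡⟨ cong (F 0 xor_) (⨁<-snoc (suc n) (F ∘ suc)) ⟩
  F 0 xor ((⨁[ i < suc n ] F (suc i)) xor F (suc (suc n)))
    ≡⟨ cong (λ b → b xor ((⨁[ i < suc n ] F (suc i)) xor F (suc (suc n)))) (F-sym 0 z≤n) ⟩
  F (suc (suc n)) xor ((⨁[ i < suc n ] F (suc i)) xor F (suc (suc n)))
    ≡⟨ cong (F (suc (suc n)) xor_) (xor-comm _ (F (suc (suc n)))) ⟩
  F (suc (suc n)) xor (F (suc (suc n)) xor (⨁[ i < suc n ] F (suc i)))
    ≡⟨ sym (xor-assoc (F (suc (suc n))) _ _) ⟩
  (F (suc (suc n)) xor F (suc (suc n))) xor (⨁[ i < suc n ] F (suc i))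
    ≡⟨ cong (_xor (⨁[ i < suc n ] F (suc i))) (xor-same (F (suc (suc n)))) ⟩
  false xor (⨁[ i < suc n ] F (suc i))
    ≡⟨ ⨁<-palindrome n (F ∘ suc) (λ i i≤n → trans (F-sym (suc i) (s≤s (m≤n⇒m≤1+n i≤n)))
                                                  (cong F (+-∸-assoc 1 i≤n))) ⟩
  centre n (F ∘ suc) ∎
  where open ≡-Reasoning

sumList : ∀ {X : Set} → List X → (X → Bool) → Bool
sumList []       P = false
sumList (x ∷ xs) P = P x xor sumList xs P

syntax sumList xs (λ x → e) = ⨁[ x ← xs ] e

module _ {X : Set} where

  ⨁←-cong : ∀ xs {P Q : X → Bool} → (∀ {x} → x ∈ xs → P x ≡ Q x) → sumList xs P ≡ sumList xs Q
  ⨁←-cong []       _   = refl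
  ⨁←-cong (x ∷ xs) P≗Q = cong₂ _xor_ (P≗Q (here refl)) (⨁←-cong xs (P≗Q ∘ there))

  ⨁←-false : ∀ xs {P : X → Bool} → (∀ {x} → x ∈ xs → P x ≡ false) → sumList xs P ≡ false
  ⨁←-false []       _   = refl
  ⨁←-false (x ∷ xs) P≡0 rewrite P≡0 (here refl) = ⨁←-false xs (P≡0 ∘ there)

  ⨁←-++ : ∀ xs ys (P : X → Bool) → sumList (xs ++ ys) P ≡ sumList xs P xor sumList ys P
  ⨁←-++ []       ys P = refl
  ⨁←-++ (x ∷ xs) ys P = trans (cong (P x xor_) (⨁←-++ xs ys P)) (sym (xor-assoc (P x) _ _))

  ⨁←-xor : ∀ xs (P Q : X → Bool) → (⨁[ x ← xs ] (P x xor Q x)) ≡ sumList xs P xor sumList xs Q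
  ⨁←-xor []       P Q = refl
  ⨁←-xor (x ∷ xs) P Q = trans (cong ((P x xor Q x) xor_) (⨁←-xor xs P Q)) (xor-interchange (P x) (Q x) _ _)

  ⨁←-∧ˡ : ∀ xs a (P : X → Bool) → a ∧ sumList xs P ≡ (⨁[ x ← xs ] (a ∧ P x))
  ⨁←-∧ˡ []       a P = ∧-zeroʳ a
  ⨁←-∧ˡ (x ∷ xs) a P = trans (∧-distribˡ-xor a (P x) _) (cong ((a ∧ P x) xor_) (⨁←-∧ˡ xs a P))

  ⨁←-split : ∀ xs (P Q : X → Bool) → sumList xs P ≡ (⨁[ x ← xs ] (P x ∧ Q x)) xor (⨁[ x ← xs ] (P x ∧ not (Q x)))
  ⨁←-split xs P Q = trans (⨁←-cong xs (λ {x} _ → split (P x) (Q x))) (⨁←-xor xs _ _)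
    where
    split : ∀ p q → p ≡ (p ∧ q) xor (p ∧ not q)
    split true  true  = refl
    split true  false = refl
    split false _     = refl

  ⨁←-map : ∀ {Y : Set} (f : Y → X) ys (P : X → Bool) → sumList (map f ys) P ≡ sumList ys (P ∘ f)
  ⨁←-map f []       P = refl
  ⨁←-map f (y ∷ ys) P = cong (P (f y) xor_) (⨁←-map f ys P)

⨁←-cartesianProduct : ∀ {X Y : Set} xs (ys : List Y) (P : X × Y → Bool) →
                      sumList (cartesianProduct xs ys) P ≡ (⨁[ x ← xs ] (⨁[ y ← ys ] P (x , y)))
⨁←-cartesianProduct []       ys P = refl
⨁←-cartesianProduct (x ∷ xs) ys P = trans (⨁←-++ (map (x ,_) ys) _ P)
  (cong₂ _xor_ (⨁←-map (x ,_) ys P) (⨁←-cartesianProduct xs ys P))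

⨁<≡⨁←upTo : ∀ n f → sumBelow n f ≡ sumList (upTo n) f
⨁<≡⨁←upTo n f = shifted n id
  where
  shifted : ∀ n (g : ℕ → ℕ) → sumBelow n (f ∘ g) ≡ sumList (applyUpTo g n) f
  shifted zero    g = refl
  shifted (suc n) g = cong (f (g 0) xor_) (shifted n (g ∘ suc))

-- Pairing off the elements of a list by an involution

module _ {X : Set} (_≟ₓ_ : DecidableEquality X) where

  ⨁←-indicator : ∀ {xs c} (P : X → Bool) → Unique xs → c ∈ xs → (⨁[ x ← xs ] (P x ∧ does (x ≟ₓ c))) ≡ P c
  ⨁←-indicator {x ∷ xs} {c} P (x∉xs ∷ _) (here refl) rewrite dec-true (x ≟ₓ x) refl =
    trans (cong (_xor (⨁[ y ← xs ] (P y ∧ does (y ≟ₓ x)))) (∧-identityʳ (P x)))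
          (trans (cong (P x xor_) (⨁←-false xs others)) (xor-identityʳ (P x)))
    where
    others : ∀ {y} → y ∈ xs → P y ∧ does (y ≟ₓ x) ≡ false
    others {y} y∈xs = trans (cong (P y ∧_) (dec-false (y ≟ₓ x) (λ y≡x → All.lookup x∉xs y∈xs (sym y≡x))))
                            (∧-zeroʳ (P y))
  ⨁←-indicator {x ∷ xs} {c} P (x∉xs ∷ xs-unique) (there c∈xs)
    rewrite dec-false (x ≟ₓ c) (λ x≡c → All.lookup x∉xs c∈xs x≡c) =
    trans (cong (_xor _) (∧-zeroʳ (P x))) (trans (xor-identityˡ _) (⨁←-indicator P xs-unique c∈xs))

  ⨁←-remove : ∀ {xs c} (P : X → Bool) → Unique xs → c ∈ xs →
              sumList xs P ≡ P c xor (⨁[ x ← xs ] (P x ∧ not (does (x ≟ₓ c))))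
  ⨁←-remove {xs} {c} P xs-unique c∈xs = trans (⨁←-split xs P (λ x → does (x ≟ₓ c)))
    (cong (_xor (⨁[ x ← xs ] (P x ∧ not (does (x ≟ₓ c))))) (⨁←-indicator P xs-unique c∈xs))

  module _ (ι : X → X) where

    InvolutiveOn : (X → Bool) → List X → Set
    InvolutiveOn P xs = ∀ {x} → x ∈ xs → P x ≡ true → ι x ∈ xs × P (ι x) ≡ true × ι (ι x) ≡ x

    ⨁←-involution : ∀ {xs} P → Unique xs → InvolutiveOn P xs → sumList xs P ≡ (⨁[ x ← xs ] (P x ∧ does (ι x ≟ₓ x)))
    ⨁←-involution {[]}     P _ _ = refl
    ⨁←-involution {x ∷ xs} P (x∉xs ∷ xs-unique) inv with P x in Px | ι x ≟ₓ x
    ... | false | _ = cong (false xor_) (⨁←-involution P xs-unique tail-involutive)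
      where
      tail-involutive : InvolutiveOn P xs
      tail-involutive y∈xs Py with inv (there y∈xs) Py
      ... | here ιy≡x  , Pιy , _    = contradiction (trans (sym Pιy) (trans (cong P ιy≡x) Px)) λ ()
      ... | there ιy∈xs , Pιy , ιιy = ιy∈xs , Pιy , ιιy
    ... | true | yes ιx≡x = cong (true xor_) (⨁←-involution P xs-unique tail-involutive)
      where
      tail-involutive : InvolutiveOn P xs
      tail-involutive {y} y∈xs Py with inv (there y∈xs) Py
      ... | here ιy≡x  , _ , ιιy = contradiction (trans (sym ιιy) (trans (cong ι ιy≡x) ιx≡x))
                                                  (λ y≡x → All.lookup x∉xs y∈xs (sym y≡x))
      ... | there ιy∈xs , Pιy , ιιy = ιy∈xs , Pιy , ιιy
    ... | true | no ιx≢x with inv (here refl) Px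
    ...   | here ιx≡x , _ = contradiction ιx≡x ιx≢x
    -- x cancels against ι x, which is then removed from the support of P
    ...   | there c∈xs , Pc , ιιx = begin
      true xor sumList xs P
        ≡⟨ cong (true xor_) (⨁←-remove P xs-unique c∈xs) ⟩
      true xor (P c xor sumList xs P′)
        ≡⟨ cong (λ b → true xor (b xor sumList xs P′)) Pc ⟩
      true xor (true xor sumList xs P′)
        ≡⟨ sym (xor-assoc true true _) ⟩
      sumList xs P′
        ≡⟨ ⨁←-involution P′ xs-unique tail-involutive ⟩
      (⨁[ y ← xs ] (P′ y ∧ does (ι y ≟ₓ y)))
        ≡⟨ ⨁←-cong xs (λ {y} _ → drop-c y) ⟩
      (⨁[ y ← xs ] (P y ∧ does (ι y ≟ₓ y))) ∎
      where
      open ≡-Reasoning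
      c = ι x
      P′ : X → Bool
      P′ y = P y ∧ not (does (y ≟ₓ c))
      drop-c : ∀ y → P′ y ∧ does (ι y ≟ₓ y) ≡ P y ∧ does (ι y ≟ₓ y)
      drop-c y with y ≟ₓ c
      ... | no  _    = cong (_∧ does (ι y ≟ₓ y)) (∧-identityʳ (P y))
      ... | yes refl rewrite ∧-zeroʳ (P c) | dec-false (ι c ≟ₓ c) (λ ιc≡c → ιx≢x (trans (sym ιc≡c) ιιx)) =
        sym (∧-zeroʳ (P c))
      tail-involutive : InvolutiveOn P′ xs
      tail-involutive {y} y∈xs P′y with y ≟ₓ c | inv (there y∈xs) (proj₁ (∧-true P′y))
      ... | yes y≡c | _ = contradiction (trans (sym P′y) (trans (cong (λ b → P y ∧ not b) (dec-true (y ≟ₓ c) y≡c))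
                                                               (∧-zeroʳ (P y)))) (λ ())
      ... | no y≢c | here ιy≡x , _ , ιιy = contradiction (trans (sym ιιy) (cong ι ιy≡x)) y≢c
      ... | no y≢c | there ιy∈xs , Pιy , ιιy = ιy∈xs , P′ιy , ιιy
        where
        ιy≢ιx : ι y ≢ ι x
        ιy≢ιx ιy≡ιx = All.lookup x∉xs y∈xs (sym (trans (sym ιιy) (trans (cong ι ιy≡ιx) ιιx)))
        P′ιy : P′ (ι y) ≡ true
        P′ιy = cong₂ (λ a b → a ∧ not b) Pιy (dec-false (ι y ≟ₓ c) ιy≢ιx)

    ⨁←-fixed-point-free : ∀ {xs} P → Unique xs → InvolutiveOn P xs →
                          (∀ {x} → x ∈ xs → P x ≡ true → ι x ≢ x) → sumList xs P ≡ false
    ⨁←-fixed-point-free {xs} P xs-unique inv free = trans (⨁←-involution P xs-unique inv) (⨁←-false xs unfixed)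
      where
      unfixed : ∀ {x} → x ∈ xs → P x ∧ does (ι x ≟ₓ x) ≡ false
      unfixed {x} x∈xs with P x in Px
      ... | false = refl
      ... | true  = dec-false (ι x ≟ₓ x) (free x∈xs Px)

-- Power series over 𝔽₂

Series₂ : Set
Series₂ = ℕ → Bool

one₂ : Series₂
one₂ zero    = true
one₂ (suc _) = false

infixl 6 _⊕_
infixl 7 _⊛_
infix 4 _≈[_]_

_⊕_ : Series₂ → Series₂ → Series₂
(f ⊕ g) i = f i xor g i

_⊛_ : Series₂ → Series₂ → Series₂
(f ⊛ g) n = ⨁[ i < suc n ] (f i ∧ g (n ∸ i))

_≈[_]_ : Series₂ → ℕ → Series₂ → Set
f ≈[ N ] g = ∀ i → i ≤ N → f i ≡ g i

≈-trans : ∀ {N f g h} → f ≈[ N ] g → g ≈[ N ] h → f ≈[ N ] h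
≈-trans f≈g g≈h i i≤N = trans (f≈g i i≤N) (g≈h i i≤N)

≈-sym : ∀ {N f g} → f ≈[ N ] g → g ≈[ N ] f
≈-sym f≈g i i≤N = sym (f≈g i i≤N)

≗⇒≈ : ∀ {N f g} → f ≗ g → f ≈[ N ] g
≗⇒≈ f≗g i _ = f≗g i

⊛-comm : ∀ f g → f ⊛ g ≗ g ⊛ f
⊛-comm f g n = trans (⨁<-reverse (suc n) (λ i → f i ∧ g (n ∸ i))) (⨁<-cong (suc n) (λ i i≤n →
  trans (cong (λ x → f (n ∸ i) ∧ g x) (m∸[m∸n]≡n (≤-pred i≤n))) (∧-comm (f (n ∸ i)) (g i))))

⊛-identityˡ : ∀ f → one₂ ⊛ f ≗ f
⊛-identityˡ f n = trans (cong (f n xor_) (⨁<-false n (λ _ _ → refl))) (xor-identityʳ (f n))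

⊛-identityʳ : ∀ f → f ⊛ one₂ ≗ f
⊛-identityʳ f n = trans (⊛-comm f one₂ n) (⊛-identityˡ f n)

⊛-distribˡ-⊕ : ∀ f g h → f ⊛ (g ⊕ h) ≗ f ⊛ g ⊕ f ⊛ h
⊛-distribˡ-⊕ f g h n = trans (⨁<-cong (suc n) (λ i _ → ∧-distribˡ-xor (f i) (g (n ∸ i)) (h (n ∸ i))))
                             (⨁<-xor (suc n) (λ i → f i ∧ g (n ∸ i)) (λ i → f i ∧ h (n ∸ i)))

⊛-distribʳ-⊕ : ∀ f g h → (g ⊕ h) ⊛ f ≗ g ⊛ f ⊕ h ⊛ f
⊛-distribʳ-⊕ f g h n = trans (⊛-comm (g ⊕ h) f n)
  (trans (⊛-distribˡ-⊕ f g h n) (cong₂ _xor_ (⊛-comm f g n) (⊛-comm f h n)))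

⊛-cong : ∀ {f f′ g g′} → f ≗ f′ → g ≗ g′ → f ⊛ g ≗ f′ ⊛ g′
⊛-cong f≗f′ g≗g′ n = ⨁<-cong (suc n) (λ i _ → cong₂ _∧_ (f≗f′ i) (g≗g′ (n ∸ i)))

⊛-congˡ : ∀ f {g g′} → g ≗ g′ → f ⊛ g ≗ f ⊛ g′
⊛-congˡ f = ⊛-cong {f = f} (λ _ → refl)

⊛-congʳ : ∀ g {f f′} → f ≗ f′ → f ⊛ g ≗ f′ ⊛ g
⊛-congʳ g f≗f′ = ⊛-cong {g = g} f≗f′ (λ _ → refl)

⊛-cong-≈ : ∀ {N f f′ g g′} → f ≈[ N ] f′ → g ≈[ N ] g′ → f ⊛ g ≈[ N ] f′ ⊛ g′
⊛-cong-≈ f≈f′ g≈g′ n n≤N = ⨁<-cong (suc n) (λ i i≤n →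
  cong₂ _∧_ (f≈f′ i (≤-trans (≤-pred i≤n) n≤N)) (g≈g′ (n ∸ i) (≤-trans (m∸n≤m n i) n≤N)))

⊛-assoc : ∀ f g h → (f ⊛ g) ⊛ h ≗ f ⊛ (g ⊛ h)
⊛-assoc f g h n = begin
  (⨁[ i < suc n ] ((f ⊛ g) i ∧ h (n ∸ i)))
    ≡⟨ ⨁<-cong (suc n) (λ i i≤n → trans (⨁<-∧ʳ (suc i) (h (n ∸ i)) (λ j → f j ∧ g (i ∸ j)))
                                         (⨁<-extend i n (λ j → term i j) (≤-pred i≤n))) ⟩
  (⨁[ i < suc n ] (⨁[ j < suc n ] ((j ≤ᵇ i) ∧ term i j)))
    ≡⟨ ⨁<-swap (suc n) (suc n) (λ i j → (j ≤ᵇ i) ∧ term i j) ⟩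
  (⨁[ j < suc n ] (⨁[ i < suc n ] ((j ≤ᵇ i) ∧ term i j)))
    ≡⟨ ⨁<-cong (suc n) inner ⟩
  (⨁[ j < suc n ] (f j ∧ (g ⊛ h) (n ∸ j))) ∎
  where
  open ≡-Reasoning
  term : ℕ → ℕ → Bool
  term i j = (f j ∧ g (i ∸ j)) ∧ h (n ∸ i)
  inner : ∀ j → j < suc n → (⨁[ i < suc n ] ((j ≤ᵇ i) ∧ term i j)) ≡ f j ∧ (g ⊛ h) (n ∸ j)
  inner j j≤n = begin
    (⨁[ i < suc n ] ((j ≤ᵇ i) ∧ term i j))        ≡⟨ ⨁<-shift j n (λ i → term i j) (≤-pred j≤n) ⟩
    (⨁[ k < suc (n ∸ j) ] term (j + k) j)          ≡⟨ ⨁<-cong (suc (n ∸ j)) (λ k _ → reassoc k) ⟩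
    (⨁[ k < suc (n ∸ j) ] (f j ∧ (g k ∧ h (n ∸ j ∸ k))))
      ≡⟨ sym (⨁<-∧ˡ (suc (n ∸ j)) (f j) (λ k → g k ∧ h (n ∸ j ∸ k))) ⟩
    f j ∧ (g ⊛ h) (n ∸ j)                           ∎
    where
    reassoc : ∀ k → term (j + k) j ≡ f j ∧ (g k ∧ h (n ∸ j ∸ k))
    reassoc k rewrite m+n∸m≡n j k | ∸-+-assoc n j k = ∧-assoc (f j) (g k) _

⊛-commutativeMonoid : CommutativeMonoid _ _
⊛-commutativeMonoid = record
  { Carrier = Series₂
  ; _≈_     = _≗_
  ; _∙_     = _⊛_
  ; ε       = one₂
  ; isCommutativeMonoid = record
    { isMonoid = record
      { isSemigroup = record
        { isMagma = record
          { isEquivalence = Setoid.isEquivalence (ℕ →-setoid Bool)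
          ; ∙-cong        = ⊛-cong }
        ; assoc = ⊛-assoc }
      ; identity = ⊛-identityˡ , ⊛-identityʳ }
    ; comm = ⊛-comm } }

open CommutativeMonoidSolver ⊛-commutativeMonoid using (solve; _⊜_) renaming (_⊕_ to _⊗_)

module ≗-Reasoning = SetoidReasoning (ℕ →-setoid Bool)

⊛-cancelˡ : ∀ {h f g} → h 0 ≡ true → h ⊛ f ≗ h ⊛ g → f ≗ g
⊛-cancelˡ {h} {f} {g} h₀ hf≗hg n = agree n n ≤-refl
  where
  agree : ∀ N → f ≈[ N ] g
  agree zero    zero    _ = xor-cancelʳ false (subst (λ b → (b ∧ f 0) xor false ≡ (b ∧ g 0) xor false) h₀ (hf≗hg 0))
  agree (suc N) i i≤N with m≤n⇒m<n∨m≡n i≤N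
  ... | inj₁ i<N  = agree N i (≤-pred i<N)
  ... | inj₂ refl = xor-cancelʳ _ (begin
    f (suc N) xor lower f         ≡⟨ cong (λ b → (b ∧ f (suc N)) xor lower f) (sym h₀) ⟩
    (h ⊛ f) (suc N)               ≡⟨ hf≗hg (suc N) ⟩
    (h ⊛ g) (suc N)               ≡⟨ cong (λ b → (b ∧ g (suc N)) xor lower g) h₀ ⟩
    g (suc N) xor lower g         ≡⟨ cong (g (suc N) xor_) (sym lower-agree) ⟩
    g (suc N) xor lower f         ∎)
    where
    open ≡-Reasoning
    lower : Series₂ → Bool
    lower u = ⨁[ i < suc N ] (h (suc i) ∧ u (N ∸ i))
    lower-agree : lower f ≡ lower g
    lower-agree = ⨁<-cong (suc N) (λ i _ → cong (h (suc i) ∧_) (agree N (N ∸ i) (m∸n≤m N i)))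

-- Dilation f(q) ↦ f(q^k)

multiple? : ∀ k n → (∃ λ q → n ≡ q * k) ⊎ ¬ k ∣ℕ n
multiple? k n with k ∣? n
... | yes (divides q n≡qk) = inj₁ (q , n≡qk)
... | no ¬k∣n             = inj₂ ¬k∣n

dilate : ℕ → Series₂ → Series₂
dilate k f n with k ∣? n
... | yes (divides q _) = f q
... | no _              = false

module _ (k : ℕ) .{{_ : NonZero k}} where

  dilate-multiple : ∀ f j → dilate k f (j * k) ≡ f j
  dilate-multiple f j with k ∣? (j * k)
  ... | yes (divides q eq) = cong f (sym (*-cancelʳ-≡ j q k eq))
  ... | no ¬k∣jk           = contradiction (divides j refl) ¬k∣jk

  dilate-nonmultiple : ∀ f {n} → ¬ k ∣ℕ n → dilate k f n ≡ false
  dilate-nonmultiple f {n} ¬k∣n with k ∣? n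
  ... | yes k∣n = contradiction k∣n ¬k∣n
  ... | no _    = refl

  ≡ᵇ-*-cancelʳ : ∀ m n → (m ≡ᵇ n) ≡ (m * k ≡ᵇ n * k)
  ≡ᵇ-*-cancelʳ m n with m ≟ n
  ... | yes refl = trans (≡ᵇ-true {m} refl) (sym (≡ᵇ-true {m * k} refl))
  ... | no  m≢n  = trans (≡ᵇ-false m≢n) (sym (≡ᵇ-false (m≢n ∘ *-cancelʳ-≡ m n k)))

  dilate-cong : ∀ {f g} → f ≗ g → dilate k f ≗ dilate k g
  dilate-cong {f} {g} f≗g n with multiple? k n
  ... | inj₁ (q , refl) = trans (dilate-multiple f q) (trans (f≗g q) (sym (dilate-multiple g q)))
  ... | inj₂ ¬k∣n        = trans (dilate-nonmultiple f ¬k∣n) (sym (dilate-nonmultiple g ¬k∣n))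

  dilate-cong-≈ : ∀ {N f g} → f ≈[ N ] g → dilate k f ≈[ N ] dilate k g
  dilate-cong-≈ {N} {f} {g} f≈g n n≤N with multiple? k n
  ... | inj₁ (q , refl) = trans (dilate-multiple f q)
                                 (trans (f≈g q (≤-trans (m≤m*n q k) n≤N)) (sym (dilate-multiple g q)))
  ... | inj₂ ¬k∣n        = trans (dilate-nonmultiple f ¬k∣n) (sym (dilate-nonmultiple g ¬k∣n))

  ∤-between-multiples : ∀ m s → 0 < s → s < k → ¬ k ∣ℕ m * k + s
  ∤-between-multiples m s 0<s s<k k∣ = <⇒≱ s<k (∣⇒≤ {{>-nonZero 0<s}} (∣m+n∣m⇒∣n k∣ (n∣m*n m)))

  ⨁<-multiples : ∀ m F → (∀ i → ¬ k ∣ℕ i → F i ≡ false) →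
                  sumBelow (suc (m * k)) F ≡ (⨁[ j < suc m ] F (j * k))
  ⨁<-multiples zero    F F≡0 = refl
  ⨁<-multiples (suc m) F F≡0 = begin
    sumBelow (suc (k + m * k)) F
      ≡⟨ cong (λ x → sumBelow (suc x) F) (+-comm k (m * k)) ⟩
    sumBelow (suc (m * k) + k) F
      ≡⟨ ⨁<-+ (suc (m * k)) k F ⟩
    sumBelow (suc (m * k)) F xor (⨁[ r < k ] F (suc (m * k) + r))
      ≡⟨ cong₂ _xor_ (⨁<-multiples m F F≡0) gap ⟩
    (⨁[ j < suc m ] F (j * k)) xor F (suc m * k)
      ≡⟨ sym (⨁<-snoc (suc m) (λ j → F (j * k))) ⟩
    (⨁[ j < suc (suc m) ] F (j * k)) ∎
    where
    open ≡-Reasoning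
    k′ = pred k
    gap : (⨁[ r < k ] F (suc (m * k) + r)) ≡ F (suc m * k)
    gap = begin
      (⨁[ r < k ] F (suc (m * k) + r))
        ≡⟨ cong (λ x → ⨁[ r < x ] F (suc (m * k) + r)) (sym (suc-pred k)) ⟩
      (⨁[ r < suc k′ ] F (suc (m * k) + r))
        ≡⟨ ⨁<-snoc k′ (λ r → F (suc (m * k) + r)) ⟩
      (⨁[ r < k′ ] F (suc (m * k) + r)) xor F (suc (m * k) + k′)
        ≡⟨ cong₂ _xor_ (⨁<-false k′ (λ r r<k′ → F≡0 _ (∤-between-multiples m (suc r) (s≤s z≤n)
                                      (subst (suc (suc r) ≤_) (suc-pred k) (s≤s r<k′))
                                      ∘ subst (k ∣ℕ_) (sym (+-suc (m * k) r)))))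
                       (cong F (trans (sym (+-suc (m * k) k′)) (trans (cong (m * k +_) (suc-pred k)) (+-comm (m * k) k)))) ⟩
      false xor F (suc m * k) ≡⟨ xor-identityˡ _ ⟩
      F (suc m * k) ∎

  dilate-⊛ : ∀ f g → dilate k (f ⊛ g) ≗ dilate k f ⊛ dilate k g
  dilate-⊛ f g n with multiple? k n
  ... | inj₁ (m , refl) = trans (dilate-multiple (f ⊛ g) m) (sym (begin
    (dilate k f ⊛ dilate k g) (m * k)
      ≡⟨ ⨁<-multiples m (λ i → dilate k f i ∧ dilate k g (m * k ∸ i)) off-multiples ⟩
    (⨁[ j < suc m ] (dilate k f (j * k) ∧ dilate k g (m * k ∸ j * k)))
      ≡⟨ ⨁<-cong (suc m) (λ j _ → cong₂ _∧_ (dilate-multiple f j)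
           (trans (cong (dilate k g) (sym (*-distribʳ-∸ k m j))) (dilate-multiple g (m ∸ j)))) ⟩
    (f ⊛ g) m ∎))
    where
    open ≡-Reasoning
    off-multiples : ∀ i → ¬ k ∣ℕ i → (dilate k f i ∧ dilate k g (m * k ∸ i)) ≡ false
    off-multiples i ¬k∣i rewrite dilate-nonmultiple f ¬k∣i = refl
  ... | inj₂ ¬k∣n = trans (dilate-nonmultiple (f ⊛ g) ¬k∣n) (sym (⨁<-false (suc n) vanishing))
    where
    vanishing : ∀ i → i < suc n → (dilate k f i ∧ dilate k g (n ∸ i)) ≡ false
    vanishing i i≤n with multiple? k i
    ... | inj₂ ¬k∣i       rewrite dilate-nonmultiple f ¬k∣i = refl
    ... | inj₁ (j , refl) = trans (cong (dilate k f (j * k) ∧_) (dilate-nonmultiple g ¬k∣n-i)) (∧-zeroʳ _)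
      where
      ¬k∣n-i : ¬ k ∣ℕ n ∸ j * k
      ¬k∣n-i k∣ = ¬k∣n (subst (k ∣ℕ_) (m+[n∸m]≡n (≤-pred i≤n)) (∣m∣n⇒∣m+n (n∣m*n j) k∣))

  dilate-one : dilate k one₂ ≗ one₂
  dilate-one n with multiple? k n
  ... | inj₁ (zero  , refl) = dilate-multiple one₂ 0
  ... | inj₁ (suc q , refl) = trans (dilate-multiple one₂ (suc q)) (sym (positive (suc q * k) {{m*n≢0 (suc q) k}}))
    where
    positive : ∀ i .{{_ : NonZero i}} → one₂ i ≡ false
    positive (suc i) = refl
  ... | inj₂ ¬k∣n with n
  ... | zero  = contradiction (divides 0 refl) ¬k∣n
  ... | suc _ = dilate-nonmultiple one₂ ¬k∣n

dilate-dilate : ∀ a b .{{_ : NonZero a}} .{{_ : NonZero b}} f → dilate a (dilate b f) ≗ dilate (b * a) f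
dilate-dilate a b f n with multiple? (b * a) n
... | inj₁ (j , refl) = begin
  dilate a (dilate b f) (j * (b * a)) ≡⟨ cong (dilate a (dilate b f)) (sym (*-assoc j b a)) ⟩
  dilate a (dilate b f) (j * b * a)   ≡⟨ dilate-multiple a (dilate b f) (j * b) ⟩
  dilate b f (j * b)                  ≡⟨ dilate-multiple b f j ⟩
  f j                                 ≡⟨ sym (dilate-multiple (b * a) {{m*n≢0 b a}} f j) ⟩
  dilate (b * a) f (j * (b * a))      ∎
  where open ≡-Reasoning
... | inj₂ ¬ba∣n = trans inner (sym (dilate-nonmultiple (b * a) {{m*n≢0 b a}} f ¬ba∣n))
  where
  inner : dilate a (dilate b f) n ≡ false
  inner with multiple? a n
  ... | inj₂ ¬a∣n       = dilate-nonmultiple a (dilate b f) ¬a∣n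
  ... | inj₁ (c , refl) = trans (dilate-multiple a (dilate b f) c)
                            (dilate-nonmultiple b f (λ { (divides-refl j) → ¬ba∣n (divides j (*-assoc j b a)) }))

dilate-⊛-residue : ∀ k .{{_ : NonZero k}} G P r → r < k → (∀ j → P (j * k + r) ≡ false) →
                   ∀ m → (dilate k G ⊛ P) (m * k + r) ≡ false
dilate-⊛-residue k G P r r<k P≡0 m = ⨁<-false (suc (m * k + r)) vanishing
  where
  vanishing : ∀ i → i < suc (m * k + r) → (dilate k G i ∧ P (m * k + r ∸ i)) ≡ false
  vanishing i i≤N with multiple? k i
  ... | inj₂ ¬k∣i       rewrite dilate-nonmultiple k G ¬k∣i = refl
  ... | inj₁ (j , refl) = trans (cong (dilate k G (j * k) ∧_) (trans (cong P shift) (P≡0 (m ∸ j)))) (∧-zeroʳ _)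
    where
    j≤m : j ≤ m
    j≤m with j ≤? m
    ... | yes j≤m = j≤m
    ... | no  j≰m = contradiction (≤-pred i≤N) (<⇒≱ (begin-strict
      m * k + r   <⟨ +-monoʳ-< (m * k) r<k ⟩
      m * k + k   ≡⟨ +-comm (m * k) k ⟩
      suc m * k   ≤⟨ *-monoˡ-≤ k (≰⇒> j≰m) ⟩
      j * k       ∎))
      where open ≤-Reasoning
    shift : m * k + r ∸ j * k ≡ (m ∸ j) * k + r
    shift = trans (+-∸-comm r (*-monoˡ-≤ k j≤m)) (cong (_+ r) (sym (*-distribʳ-∸ k m j)))

-- Frobenius: squaring over 𝔽₂ is the dilation by 2

data ParityView : ℕ → Set where
  even : ∀ m → ParityView (m * 2)
  odd  : ∀ m → ParityView (suc (m * 2))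

parityView : ∀ n → ParityView n
parityView zero = even 0
parityView (suc n) with parityView n
... | even m = odd m
... | odd m  = even (suc m)

⊛-self-centre : ∀ f n → (f ⊛ f) n ≡ centre n (λ i → f i ∧ f (n ∸ i))
⊛-self-centre f n = ⨁<-palindrome n (λ i → f i ∧ f (n ∸ i)) (λ i i≤n →
  trans (∧-comm (f i) _) (cong (λ x → f (n ∸ i) ∧ f x) (sym (m∸[m∸n]≡n i≤n))))

⊛-self : ∀ f → f ⊛ f ≗ dilate 2 f
⊛-self f n with parityView n
... | even m = begin
  (f ⊛ f) (m * 2)           ≡⟨ trans (⊛-self-centre f (m * 2)) (centre-even m _) ⟩
  f m ∧ f (m * 2 ∸ m)       ≡⟨ cong (λ x → f m ∧ f x) (trans (cong (_∸ m) (*-comm m 2)) (m+n∸m≡n m (m + 0))) ⟩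
  f m ∧ f (m + 0)           ≡⟨ cong (λ x → f m ∧ f x) (+-identityʳ m) ⟩
  f m ∧ f m                 ≡⟨ ∧-idem (f m) ⟩
  f m                       ≡⟨ sym (dilate-multiple 2 f m) ⟩
  dilate 2 f (m * 2)        ∎
  where open ≡-Reasoning
... | odd m = begin
  (f ⊛ f) (suc (m * 2))     ≡⟨ trans (⊛-self-centre f (suc (m * 2))) (centre-odd m _) ⟩
  false                     ≡⟨ sym (dilate-nonmultiple 2 f (∤-between-multiples 2 m 1 (s≤s z≤n) (s≤s (s≤s z≤n))
                                                            ∘ subst (2 ∣ℕ_) (+-comm 1 (m * 2)))) ⟩
  dilate 2 f (suc (m * 2))  ∎
  where open ≡-Reasoning

⊛-fourth : ∀ f → f ⊛ f ⊛ (f ⊛ f) ≗ dilate 4 f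
⊛-fourth f = begin
  f ⊛ f ⊛ (f ⊛ f)       ≈⟨ ⊛-self (f ⊛ f) ⟩
  dilate 2 (f ⊛ f)      ≈⟨ dilate-cong 2 (⊛-self f) ⟩
  dilate 2 (dilate 2 f) ≈⟨ dilate-dilate 2 2 f ⟩
  dilate 4 f            ∎
  where open ≗-Reasoning

-- multiplication by 1 + q^m, the reduction modulo 2 of Defs.times1-
times1+ : ℕ → Series₂ → Series₂
times1+ m f i = f i xor ((m ≤ᵇ i) ∧ f (i ∸ m))

prod₂ : List ℕ → Series₂
prod₂ = foldr times1+ one₂

monomial : ℕ → Series₂
monomial m i = i ≡ᵇ m

binomial : ℕ → Series₂
binomial m = one₂ ⊕ monomial m

monomial-⊛ : ∀ m f i → (monomial m ⊛ f) i ≡ (m ≤ᵇ i) ∧ f (i ∸ m)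
monomial-⊛ m f i = trans (⨁<-indicator (suc i) m (λ j → f (i ∸ j))) (cong (_∧ f (i ∸ m)) (<ᵇ-suc m i))

times1+≗⊛ : ∀ m f → times1+ m f ≗ binomial m ⊛ f
times1+≗⊛ m f i = sym (trans (⊛-distribʳ-⊕ f one₂ (monomial m) i)
                             (cong₂ _xor_ (⊛-identityˡ f i) (monomial-⊛ m f i)))

times1+-cong : ∀ m {f g} → f ≗ g → times1+ m f ≗ times1+ m g
times1+-cong m f≗g i = cong₂ (λ a b → a xor ((m ≤ᵇ i) ∧ b)) (f≗g i) (f≗g (i ∸ m))

prod₂-++ : ∀ xs ys → prod₂ (xs ++ ys) ≗ prod₂ xs ⊛ prod₂ ys
prod₂-++ []       ys i = sym (⊛-identityˡ (prod₂ ys) i)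
prod₂-++ (m ∷ xs) ys i = begin
  times1+ m (prod₂ (xs ++ ys)) i                  ≡⟨ times1+-cong m (prod₂-++ xs ys) i ⟩
  times1+ m (prod₂ xs ⊛ prod₂ ys) i               ≡⟨ times1+≗⊛ m (prod₂ xs ⊛ prod₂ ys) i ⟩
  (binomial m ⊛ (prod₂ xs ⊛ prod₂ ys)) i ≡⟨ sym (⊛-assoc (binomial m) (prod₂ xs) (prod₂ ys) i) ⟩
  (binomial m ⊛ prod₂ xs ⊛ prod₂ ys) i   ≡⟨ ⊛-congʳ (prod₂ ys) (λ j → sym (times1+≗⊛ m (prod₂ xs) j)) i ⟩
  (prod₂ (m ∷ xs) ⊛ prod₂ ys) i                   ∎
  where open ≡-Reasoning

prod₂-high : ∀ {N} ys → All (N <_) ys → prod₂ ys ≈[ N ] one₂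
prod₂-high []       []           i _   = refl
prod₂-high (m ∷ ys) (N<m ∷ N<ys) i i≤N = trans
  (cong₂ _xor_ (prod₂-high ys N<ys i i≤N) (cong (_∧ prod₂ ys (i ∸ m)) (≤ᵇ-false (≤-<-trans i≤N N<m))))
  (xor-identityʳ (one₂ i))

prod₂-truncate : ∀ {N} xs ys → All (N <_) ys → prod₂ (xs ++ ys) ≈[ N ] prod₂ xs
prod₂-truncate xs ys N<ys = ≈-trans (≗⇒≈ (prod₂-++ xs ys))
  (≈-trans (⊛-cong-≈ {f = prod₂ xs} (λ _ _ → refl) (prod₂-high ys N<ys)) (≗⇒≈ (⊛-identityʳ (prod₂ xs))))

module _ (k : ℕ) .{{_ : NonZero k}} where

  dilate-monomial : ∀ m → dilate k (monomial m) ≗ monomial (m * k)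
  dilate-monomial m n with multiple? k n
  ... | inj₁ (j , refl) = trans (dilate-multiple k (monomial m) j) (≡ᵇ-*-cancelʳ k j m)
  ... | inj₂ ¬k∣n = trans (dilate-nonmultiple k (monomial m) ¬k∣n) (sym (≡ᵇ-false (λ n≡mk → ¬k∣n (divides m n≡mk))))

  dilate-prod₂ : ∀ ms → dilate k (prod₂ ms) ≗ prod₂ (map (_* k) ms)
  dilate-prod₂ []       = dilate-one k
  dilate-prod₂ (m ∷ ms) i = begin
    dilate k (times1+ m (prod₂ ms)) i
      ≡⟨ dilate-cong k (times1+≗⊛ m (prod₂ ms)) i ⟩
    dilate k (binomial m ⊛ prod₂ ms) i
      ≡⟨ dilate-⊛ k (binomial m) (prod₂ ms) i ⟩
    (dilate k (binomial m) ⊛ dilate k (prod₂ ms)) i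
      ≡⟨ ⊛-cong dilate-binomial (dilate-prod₂ ms) i ⟩
    (binomial (m * k) ⊛ prod₂ (map (_* k) ms)) i
      ≡⟨ sym (times1+≗⊛ (m * k) (prod₂ (map (_* k) ms)) i) ⟩
    prod₂ (map (_* k) (m ∷ ms)) i ∎
    where
    open ≡-Reasoning
    dilate-binomial : dilate k (binomial m) ≗ binomial (m * k)
    dilate-binomial n with multiple? k n
    ... | inj₁ (j , refl) = trans (dilate-multiple k _ j)
                                  (cong₂ _xor_ (trans (sym (dilate-multiple k one₂ j)) (dilate-one k (j * k)))
                                               (trans (sym (dilate-multiple k (monomial m) j)) (dilate-monomial m (j * k))))
    ... | inj₂ ¬k∣n = trans (dilate-nonmultiple k _ ¬k∣n)
                            (cong₂ _xor_ (trans (sym (dilate-nonmultiple k one₂ ¬k∣n)) (dilate-one k n))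
                                         (trans (sym (dilate-nonmultiple k (monomial m) ¬k∣n)) (dilate-monomial m n)))

-- Infinite products

Growing : (ℕ → List ℕ) → Set
Growing F = ∀ n k → ∃ λ ys → F (n + k) ≡ F n ++ ys × All (n <_) ys

-- For growing F, the coefficient of q^i in ∏_{m ∈ F n} (1 + q^m) no longer changes once n ≥ i.
limit : (ℕ → List ℕ) → Series₂
limit F i = prod₂ (F i) i

limit-≈ : ∀ {F} → Growing F → ∀ N → limit F ≈[ N ] prod₂ (F N)
limit-≈ {F} grow N i i≤N with grow i (N ∸ i)
... | ys , F[N]≡F[i]++ys , i<ys = sym (begin
  prod₂ (F N) i         ≡⟨ cong (λ n → prod₂ (F n) i) (sym (m+[n∸m]≡n i≤N)) ⟩
  prod₂ (F (i + (N ∸ i))) i ≡⟨ cong (λ L → prod₂ L i) F[N]≡F[i]++ys ⟩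
  prod₂ (F i ++ ys) i   ≡⟨ prod₂-truncate (F i) ys i<ys i ≤-refl ⟩
  prod₂ (F i) i         ∎)
  where open ≡-Reasoning

upTo-+ : ∀ n k → upTo (n + k) ≡ upTo n ++ map (n +_) (upTo k)
upTo-+ n k = trans (applyUpTo-+ id n k) (cong (upTo n ++_) (sym (map-applyUpTo id (n +_) k)))
  where
  applyUpTo-+ : ∀ (f : ℕ → ℕ) n k → applyUpTo f (n + k) ≡ applyUpTo f n ++ applyUpTo (f ∘ (n +_)) k
  applyUpTo-+ f zero    k = refl
  applyUpTo-+ f (suc n) k = cong (f 0 ∷_) (applyUpTo-+ (f ∘ suc) n k)

map-upTo-growing : ∀ g → (∀ i → i < g i) → Growing (λ n → map g (upTo n))
map-upTo-growing g i<g[i] n k =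
  map (g ∘ (n +_)) (upTo k) ,
  trans (cong (map g) (upTo-+ n k)) (trans (map-++ g (upTo n) _) (cong (map g (upTo n) ++_) (sym (map-∘ (upTo k))))) ,
  Allₚ.map⁺ (Allₚ.applyUpTo⁺₂ id k (λ j → ≤-<-trans (m≤m+n n j) (i<g[i] (n + j))))

positives : ℕ → List ℕ
positives n = map suc (upTo n)

-- E and O are (q;q)_∞ and (q;q²)_∞ modulo 2
E O : Series₂
E = limit positives
O = limit odds

positives-growing : Growing positives
positives-growing = map-upTo-growing suc (λ i → ≤-refl)

odds-growing : Growing odds
odds-growing = map-upTo-growing (λ j → 2 * j + 1) (λ j → ≤-<-trans (m≤m+n j (j + 0)) (m<m+n (2 * j) (s≤s z≤n)))

positives-suc : ∀ n → positives (suc n) ≡ positives n ++ suc n ∷ []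
positives-suc n = trans (cong (map suc) (sym (upTo-∷ʳ n))) (map-++ suc (upTo n) _)

odds-suc : ∀ n → odds (suc n) ≡ odds n ++ suc (n + n) ∷ []
odds-suc n = trans (cong (map (λ j → 2 * j + 1)) (sym (upTo-∷ʳ n)))
                   (trans (map-++ _ (upTo n) _) (cong (λ m → odds n ++ m ∷ []) (2n+1≡1+n+n n)))
  where
  2n+1≡1+n+n : ∀ n → 2 * n + 1 ≡ suc (n + n)
  2n+1≡1+n+n = solve-∀

-- 1, …, 2n are the odd numbers below 2n together with the doubles of 1, …, n
positives-odd-even : ∀ n → prod₂ (positives (n + n)) ≗ prod₂ (odds n) ⊛ prod₂ (map (_* 2) (positives n))
positives-odd-even zero    = λ i → sym (⊛-identityˡ one₂ i)
positives-odd-even (suc n) = begin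
  prod₂ (positives (suc n + suc n))
    ≡⟨ cong (prod₂ ∘ positives ∘ suc) (+-suc n n) ⟩
  prod₂ (positives (suc (suc (n + n))))
    ≡⟨ cong prod₂ (trans (positives-suc (suc (n + n))) (cong (_++ suc a ∷ []) (positives-suc (n + n)))) ⟩
  prod₂ ((positives (n + n) ++ a ∷ []) ++ suc a ∷ [])
    ≈⟨ prod₂-++ (positives (n + n) ++ a ∷ []) _ ⟩
  prod₂ (positives (n + n) ++ a ∷ []) ⊛ factor (suc a)
    ≈⟨ ⊛-congʳ (factor (suc a)) (prod₂-++ (positives (n + n)) (a ∷ [])) ⟩
  prod₂ (positives (n + n)) ⊛ factor a ⊛ factor (suc a)
    ≈⟨ ⊛-congʳ (factor (suc a)) (⊛-congʳ (factor a) (positives-odd-even n)) ⟩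
  prod₂ (odds n) ⊛ prod₂ doubles ⊛ factor a ⊛ factor (suc a)
    ≈⟨ solve 4 (λ o d x y → ((o ⊗ d) ⊗ x) ⊗ y ⊜ (o ⊗ x) ⊗ (d ⊗ y)) (λ _ → refl)
             (prod₂ (odds n)) (prod₂ doubles) (factor a) (factor (suc a)) ⟩
  (prod₂ (odds n) ⊛ factor a) ⊛ (prod₂ doubles ⊛ factor (suc a))
    ≈⟨ ⊛-cong (λ i → sym (prod₂-++ (odds n) (a ∷ []) i)) (λ i → sym (prod₂-++ doubles (suc a ∷ []) i)) ⟩
  prod₂ (odds n ++ a ∷ []) ⊛ prod₂ (doubles ++ suc a ∷ [])
    ≡⟨ cong₂ (λ xs ys → prod₂ xs ⊛ prod₂ ys) (sym (odds-suc n))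
             (sym (trans (cong (map (_* 2)) (positives-suc n))
                         (trans (map-++ (_* 2) (positives n) _) (cong (λ m → doubles ++ m ∷ []) (2+2n≡2+n+n n))))) ⟩
  prod₂ (odds (suc n)) ⊛ prod₂ (map (_* 2) (positives (suc n))) ∎
  where
  open ≗-Reasoning
  a = suc (n + n)
  doubles = map (_* 2) (positives n)
  factor : ℕ → Series₂
  factor m = prod₂ (m ∷ [])
  2+2n≡2+n+n : ∀ n → suc n * 2 ≡ suc (suc (n + n))
  2+2n≡2+n+n = solve-∀

E≗O⊛E[q²] : E ≗ O ⊛ dilate 2 E
E≗O⊛E[q²] n = begin
  E n                                                   ≡⟨ limit-≈ positives-growing (n + n) n (m≤m+n n n) ⟩
  prod₂ (positives (n + n)) n                           ≡⟨ positives-odd-even n n ⟩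
  (prod₂ (odds n) ⊛ prod₂ (map (_* 2) (positives n))) n
    ≡⟨ ⊛-congˡ (prod₂ (odds n)) (λ i → sym (dilate-prod₂ 2 (positives n) i)) n ⟩
  (prod₂ (odds n) ⊛ dilate 2 (prod₂ (positives n))) n   ≡⟨ ⊛-cong-≈ (≈-sym (limit-≈ odds-growing n))
                                                              (dilate-cong-≈ 2 (≈-sym (limit-≈ positives-growing n))) n ≤-refl ⟩
  (O ⊛ dilate 2 E) n                                    ∎
  where open ≡-Reasoning

O⊛E≗one : O ⊛ E ≗ one₂
O⊛E≗one = ⊛-cancelˡ {h = E} refl (begin
  E ⊛ (O ⊛ E)          ≈⟨ solve 2 (λ e o → e ⊗ (o ⊗ e) ⊜ o ⊗ (e ⊗ e)) (λ _ → refl) E O ⟩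
  O ⊛ (E ⊛ E)          ≈⟨ ⊛-congˡ O (⊛-self E) ⟩
  O ⊛ dilate 2 E       ≈⟨ (λ i → sym (E≗O⊛E[q²] i)) ⟩
  E                    ≈⟨ (λ i → sym (⊛-identityʳ E i)) ⟩
  E ⊛ one₂             ∎)
  where open ≗-Reasoning

-- Theta-type series Σ_{a ≥ 0} q^{t a}

seriesOf : (ℕ → ℕ) → Series₂
seriesOf t i = ⨁[ a < suc i ] (t a ≡ᵇ i)

module _ (t : ℕ → ℕ) (a≤t[a] : ∀ a → a ≤ t a) where

  seriesOf-⊛ : ∀ G N → (seriesOf t ⊛ G) N ≡ (⨁[ a < suc N ] ((t a ≤ᵇ N) ∧ G (N ∸ t a)))
  seriesOf-⊛ G N = begin
    (⨁[ i < suc N ] (seriesOf t i ∧ G (N ∸ i)))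
      ≡⟨ ⨁<-cong (suc N) (λ i i≤N → trans (⨁<-∧ʳ (suc i) (G (N ∸ i)) (λ a → t a ≡ᵇ i))
                                          (⨁<-extend i N (λ a → (t a ≡ᵇ i) ∧ G (N ∸ i)) (≤-pred i≤N))) ⟩
    (⨁[ i < suc N ] (⨁[ a < suc N ] ((a ≤ᵇ i) ∧ ((t a ≡ᵇ i) ∧ G (N ∸ i)))))
      ≡⟨ ⨁<-swap (suc N) (suc N) (λ i a → (a ≤ᵇ i) ∧ ((t a ≡ᵇ i) ∧ G (N ∸ i))) ⟩
    (⨁[ a < suc N ] (⨁[ i < suc N ] ((a ≤ᵇ i) ∧ ((t a ≡ᵇ i) ∧ G (N ∸ i)))))
      ≡⟨ ⨁<-cong (suc N) (λ a _ → trans (⨁<-cong (suc N) (λ i _ → reorder a i))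
                                        (⨁<-indicator (suc N) (t a) (λ i → (a ≤ᵇ i) ∧ G (N ∸ i)))) ⟩
    (⨁[ a < suc N ] ((t a <ᵇ suc N) ∧ ((a ≤ᵇ t a) ∧ G (N ∸ t a))))
      ≡⟨ ⨁<-cong (suc N) (λ a _ → cong₂ (λ x y → x ∧ (y ∧ G (N ∸ t a))) (<ᵇ-suc (t a) N) (≤ᵇ-true (a≤t[a] a))) ⟩
    (⨁[ a < suc N ] ((t a ≤ᵇ N) ∧ G (N ∸ t a))) ∎
    where
    open ≡-Reasoning
    reorder : ∀ a i → (a ≤ᵇ i) ∧ ((t a ≡ᵇ i) ∧ G (N ∸ i)) ≡ (i ≡ᵇ t a) ∧ ((a ≤ᵇ i) ∧ G (N ∸ i))
    reorder a i rewrite ≡ᵇ-comm (t a) i = trans (sym (∧-assoc (a ≤ᵇ i) _ _))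
      (trans (cong (_∧ G (N ∸ i)) (∧-comm (a ≤ᵇ i) (i ≡ᵇ t a))) (∧-assoc (i ≡ᵇ t a) _ _))

  seriesOf-above : ∀ i b → i < b → (t b ≡ᵇ i) ≡ false
  seriesOf-above i b i<b = ≡ᵇ-false (λ t[b]≡i → <⇒≱ i<b (≤-trans (a≤t[a] b) (≤-reflexive t[b]≡i)))

  dilate-seriesOf : ∀ k .{{_ : NonZero k}} → dilate k (seriesOf t) ≗ seriesOf (λ a → t a * k)
  dilate-seriesOf k n with multiple? k n
  ... | inj₁ (q , refl) = begin
    dilate k (seriesOf t) (q * k)             ≡⟨ dilate-multiple k (seriesOf t) q ⟩
    (⨁[ a < suc q ] (t a ≡ᵇ q))               ≡⟨ ⨁<-extend-vanishing q (q * k) _ (m≤m*n q k) (λ b q<b → seriesOf-above q b q<b) ⟩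
    (⨁[ a < suc (q * k) ] (t a ≡ᵇ q))         ≡⟨ ⨁<-cong (suc (q * k)) (λ a _ → ≡ᵇ-*-cancelʳ k (t a) q) ⟩
    (⨁[ a < suc (q * k) ] (t a * k ≡ᵇ q * k)) ∎
    where open ≡-Reasoning
  ... | inj₂ ¬k∣n = trans (dilate-nonmultiple k (seriesOf t) ¬k∣n)
                          (sym (⨁<-false (suc n) (λ a _ → ≡ᵇ-false (λ t[a]k≡n → ¬k∣n (divides (t a) (sym t[a]k≡n))))))

module _ (s t : ℕ → ℕ) (a≤s[a] : ∀ a → a ≤ s a) (b≤t[b] : ∀ b → b ≤ t b) where

  seriesOf-⊛-seriesOf : ∀ N → (seriesOf s ⊛ seriesOf t) N ≡
                        (⨁[ ab ← cartesianProduct (upTo (suc N)) (upTo (suc N)) ] (s (proj₁ ab) + t (proj₂ ab) ≡ᵇ N))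
  seriesOf-⊛-seriesOf N = begin
    (seriesOf s ⊛ seriesOf t) N
      ≡⟨ seriesOf-⊛ s a≤s[a] (seriesOf t) N ⟩
    (⨁[ a < suc N ] ((s a ≤ᵇ N) ∧ seriesOf t (N ∸ s a)))
      ≡⟨ ⨁<-cong (suc N) (λ a _ → pairs-with a) ⟩
    (⨁[ a < suc N ] (⨁[ b < suc N ] (s a + t b ≡ᵇ N)))
      ≡⟨ trans (⨁<≡⨁←upTo (suc N) (λ a → ⨁[ b < suc N ] (s a + t b ≡ᵇ N)))
               (⨁←-cong (upTo (suc N)) (λ {a} _ → ⨁<≡⨁←upTo (suc N) (λ b → s a + t b ≡ᵇ N))) ⟩
    (⨁[ a ← upTo (suc N) ] (⨁[ b ← upTo (suc N) ] (s a + t b ≡ᵇ N)))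
      ≡⟨ sym (⨁←-cartesianProduct (upTo (suc N)) (upTo (suc N)) (λ ab → s (proj₁ ab) + t (proj₂ ab) ≡ᵇ N)) ⟩
    (⨁[ ab ← cartesianProduct (upTo (suc N)) (upTo (suc N)) ] (s (proj₁ ab) + t (proj₂ ab) ≡ᵇ N)) ∎
    where
    open ≡-Reasoning
    pairs-with : ∀ a → (s a ≤ᵇ N) ∧ seriesOf t (N ∸ s a) ≡ (⨁[ b < suc N ] (s a + t b ≡ᵇ N))
    pairs-with a = begin
      (s a ≤ᵇ N) ∧ (⨁[ b < suc (N ∸ s a) ] (t b ≡ᵇ N ∸ s a))
        ≡⟨ cong ((s a ≤ᵇ N) ∧_) (⨁<-extend-vanishing (N ∸ s a) N _ (m∸n≤m N (s a))
                                                     (λ b → seriesOf-above t b≤t[b] (N ∸ s a) b)) ⟩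
      (s a ≤ᵇ N) ∧ (⨁[ b < suc N ] (t b ≡ᵇ N ∸ s a))
        ≡⟨ ⨁<-∧ˡ (suc N) (s a ≤ᵇ N) (λ b → t b ≡ᵇ N ∸ s a) ⟩
      (⨁[ b < suc N ] ((s a ≤ᵇ N) ∧ (t b ≡ᵇ N ∸ s a)))
        ≡⟨ ⨁<-cong (suc N) (λ b _ → ≤ᵇ-∧-≡ᵇ (s a) (t b) N) ⟩
      (⨁[ b < suc N ] (s a + t b ≡ᵇ N)) ∎

triangle : ℕ → ℕ
triangle zero    = 0
triangle (suc a) = triangle a + suc a

ψ : Series₂
ψ = seriesOf triangle

a≤triangle[a] : ∀ a → a ≤ triangle a
a≤triangle[a] zero    = z≤n
a≤triangle[a] (suc a) = m≤n+m (suc a) (triangle a)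

triangle-double : ∀ a → triangle a * 2 ≡ a * suc a
triangle-double zero    = refl
triangle-double (suc a) = begin
  (triangle a + suc a) * 2         ≡⟨ *-distribʳ-+ 2 (triangle a) (suc a) ⟩
  triangle a * 2 + suc a * 2       ≡⟨ cong (_+ suc a * 2) (triangle-double a) ⟩
  a * suc a + suc a * 2            ≡⟨ expand a ⟩
  suc a * suc (suc a)              ∎
  where
  open ≡-Reasoning
  expand : ∀ a → a * suc a + suc a * 2 ≡ suc a * suc (suc a)
  expand = solve-∀

-- Subsets of {0, …, n - 1} as characteristic vectors

subsets : ∀ n → List (Vec Bool n)
subsets zero    = [] ∷ []
subsets (suc n) = map (false ∷_) (subsets n) ++ map (true ∷_) (subsets n)

∈-subsets : ∀ {n} (u : Vec Bool n) → u ∈ subsets n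
∈-subsets []                 = here refl
∈-subsets (false ∷ u)        = ∈-++⁺ˡ (∈-map⁺ (false ∷_) (∈-subsets u))
∈-subsets {suc n} (true ∷ u) = ∈-++⁺ʳ (map (false ∷_) (subsets n)) (∈-map⁺ (true ∷_) (∈-subsets u))

subsets-unique : ∀ n → Unique (subsets n)
subsets-unique zero    = [] ∷ []
subsets-unique (suc n) = Uniqueₚ.++⁺ (Uniqueₚ.map⁺ ∷-injectiveʳ (subsets-unique n))
                                     (Uniqueₚ.map⁺ ∷-injectiveʳ (subsets-unique n)) heads-differ
  where
  heads-differ : Disjoint (map (false ∷_) (subsets n)) (map (true ∷_) (subsets n))
  heads-differ (u∈ , w∈) with ∈-map⁻ (false ∷_) u∈ | ∈-map⁻ (true ∷_) w∈
  ... | _ , _ , refl | _ , _ , ()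

⨁←-subsets-suc : ∀ n (P : Vec Bool (suc n) → Bool) →
                 sumList (subsets (suc n)) P ≡ (⨁[ u ← subsets n ] P (false ∷ u)) xor
                                               (⨁[ u ← subsets n ] P (true ∷ u))
⨁←-subsets-suc n P = trans (⨁←-++ (map (false ∷_) (subsets n)) _ P)
                           (cong₂ _xor_ (⨁←-map (false ∷_) (subsets n) P) (⨁←-map (true ∷_) (subsets n) P))

select : Bool → ℕ → ℕ
select true  x = x
select false _ = 0

weighted : ∀ {n} → (ℕ → ℕ) → Vec Bool n → ℕ
weighted g []      = 0
weighted g (b ∷ u) = select b (g 0) + weighted (g ∘ suc) u

size : ∀ {n} → Vec Bool n → ℕ
size = weighted (λ _ → 1)

weighted-cong : ∀ {n g h} → (∀ j → g j ≡ h j) → (u : Vec Bool n) → weighted g u ≡ weighted h u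
weighted-cong g≗h []      = refl
weighted-cong g≗h (b ∷ u) = cong₂ (λ x y → select b x + y) (g≗h 0) (weighted-cong (g≗h ∘ suc) u)

weighted-+ : ∀ {n} g h (u : Vec Bool n) → weighted (λ j → g j + h j) u ≡ weighted g u + weighted h u
weighted-+ g h []      = refl
weighted-+ g h (b ∷ u) = begin
  select b (g 0 + h 0) + weighted (λ j → g (suc j) + h (suc j)) u
    ≡⟨ cong₂ _+_ (select-+ b) (weighted-+ (g ∘ suc) (h ∘ suc) u) ⟩
  (select b (g 0) + select b (h 0)) + (weighted (g ∘ suc) u + weighted (h ∘ suc) u)
    ≡⟨ +-interchange (select b (g 0)) (select b (h 0)) (weighted (g ∘ suc) u) (weighted (h ∘ suc) u) ⟩
  (select b (g 0) + weighted (g ∘ suc) u) + (select b (h 0) + weighted (h ∘ suc) u) ∎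
  where
  open ≡-Reasoning
  select-+ : ∀ b → select b (g 0 + h 0) ≡ select b (g 0) + select b (h 0)
  select-+ true  = refl
  select-+ false = refl
  +-interchange : ∀ a b c d → (a + b) + (c + d) ≡ (a + c) + (b + d)
  +-interchange = solve-∀

weighted-∷ʳ : ∀ {n} g (u : Vec Bool n) b → weighted g (u ∷ʳ b) ≡ weighted g u + select b (g n)
weighted-∷ʳ g []      b = +-identityʳ (select b (g 0))
weighted-∷ʳ g (c ∷ u) b = trans (cong (select c (g 0) +_) (weighted-∷ʳ (g ∘ suc) u b))
                                (sym (+-assoc (select c (g 0)) _ _))

weighted-shift : ∀ {n} g (u : Vec Bool n) → weighted (λ j → suc (g j)) u ≡ weighted g u + size u
weighted-shift g u = trans (weighted-cong (λ j → +-comm 1 (g j)) u) (weighted-+ g (λ _ → 1) u)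

weighted-suc : ∀ {n} (u : Vec Bool n) → weighted suc u ≡ weighted id u + size u
weighted-suc = weighted-shift id

size≤weighted : ∀ {n g} → (∀ j → 1 ≤ g j) → (u : Vec Bool n) → size u ≤ weighted g u
size≤weighted 1≤g []          = z≤n
size≤weighted 1≤g (true ∷ u)  = +-mono-≤ (1≤g 0) (size≤weighted (1≤g ∘ suc) u)
size≤weighted 1≤g (false ∷ u) = size≤weighted (1≤g ∘ suc) u

select-not+select : ∀ b → select (not b) 1 + select b 1 ≡ 1
select-not+select true  = refl
select-not+select false = refl

size≤suc-weighted-id : ∀ {n} (v : Vec Bool n) → size v ≤ suc (weighted id v)
size≤suc-weighted-id []          = z≤n
size≤suc-weighted-id (true ∷ w)  = s≤s (size≤weighted (λ _ → s≤s z≤n) w)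
size≤suc-weighted-id (false ∷ w) = m≤n⇒m≤1+n (size≤weighted (λ _ → s≤s z≤n) w)

init∷ʳlast : ∀ {n} (v : Vec Bool (suc n)) → init v ∷ʳ last v ≡ v
init∷ʳlast v = sym (proj₂ (proj₂ (initLast v)))

last-absent : ∀ {n} g (v : Vec Bool (suc n)) → weighted g v < g n → last v ≡ false
last-absent {n} g v small with last v in last≡
... | false = refl
... | true  = contradiction (begin
  g n                                   ≤⟨ m≤n+m (g n) _ ⟩
  weighted g (init v) + g n             ≡⟨ sym (weighted-∷ʳ g (init v) true) ⟩
  weighted g (init v ∷ʳ true)           ≡⟨ cong (λ b → weighted g (init v ∷ʳ b)) (sym last≡) ⟩
  weighted g (init v ∷ʳ last v)         ≡⟨ cong (weighted g) (init∷ʳlast v) ⟩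
  weighted g v                          ∎) (<⇒≱ small)
  where open ≤-Reasoning

size-∷ʳ-false : ∀ {n} (u : Vec Bool n) → size (u ∷ʳ false) ≡ size u
size-∷ʳ-false u = trans (weighted-∷ʳ (λ _ → 1) u false) (+-identityʳ (size u))

weighted-init : ∀ {n} g (v : Vec Bool (suc n)) → last v ≡ false → weighted g (init v) ≡ weighted g v
weighted-init g v last≡false = begin
  weighted g (init v)                ≡⟨ sym (+-identityʳ _) ⟩
  weighted g (init v) + 0            ≡⟨ sym (weighted-∷ʳ g (init v) false) ⟩
  weighted g (init v ∷ʳ false)       ≡⟨ cong (λ b → weighted g (init v ∷ʳ b)) (sym last≡false) ⟩
  weighted g (init v ∷ʳ last v)      ≡⟨ cong (weighted g) (init∷ʳlast v) ⟩
  weighted g v                       ∎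
  where open ≡-Reasoning

init∷ʳfalse : ∀ {n} (v : Vec Bool (suc n)) → last v ≡ false → init v ∷ʳ false ≡ v
init∷ʳfalse v last≡false = trans (cong (init v ∷ʳ_) (sym last≡false)) (init∷ʳlast v)

prod₂-applyUpTo-++ : ∀ g n ys i → prod₂ (applyUpTo g n ++ ys) i ≡
                     (⨁[ u ← subsets n ] ((weighted g u ≤ᵇ i) ∧ prod₂ ys (i ∸ weighted g u)))
prod₂-applyUpTo-++ g zero    ys i = sym (xor-identityʳ (prod₂ ys i))
prod₂-applyUpTo-++ g (suc n) ys i = begin
  prod₂ rest i xor ((g 0 ≤ᵇ i) ∧ prod₂ rest (i ∸ g 0))
    ≡⟨ cong₂ (λ a b → a xor ((g 0 ≤ᵇ i) ∧ b))
             (prod₂-applyUpTo-++ (g ∘ suc) n ys i) (prod₂-applyUpTo-++ (g ∘ suc) n ys (i ∸ g 0)) ⟩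
  (⨁[ u ← subsets n ] ((W u ≤ᵇ i) ∧ Y (i ∸ W u)))
    xor ((g 0 ≤ᵇ i) ∧ (⨁[ u ← subsets n ] ((W u ≤ᵇ i ∸ g 0) ∧ Y (i ∸ g 0 ∸ W u))))
    ≡⟨ cong ((⨁[ u ← subsets n ] ((W u ≤ᵇ i) ∧ Y (i ∸ W u))) xor_)
            (trans (⨁←-∧ˡ (subsets n) (g 0 ≤ᵇ i) (λ u → (W u ≤ᵇ i ∸ g 0) ∧ Y (i ∸ g 0 ∸ W u)))
                   (⨁←-cong (subsets n) (λ {u} _ → merge (W u)))) ⟩
  (⨁[ u ← subsets n ] ((W u ≤ᵇ i) ∧ Y (i ∸ W u))) xor (⨁[ u ← subsets n ] ((g 0 + W u ≤ᵇ i) ∧ Y (i ∸ (g 0 + W u))))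
    ≡⟨ sym (⨁←-subsets-suc n (λ u → (weighted g u ≤ᵇ i) ∧ Y (i ∸ weighted g u))) ⟩
  (⨁[ u ← subsets (suc n) ] ((weighted g u ≤ᵇ i) ∧ Y (i ∸ weighted g u))) ∎
  where
  open ≡-Reasoning
  rest = applyUpTo (g ∘ suc) n ++ ys
  Y = prod₂ ys
  W : Vec Bool n → ℕ
  W = weighted (g ∘ suc)
  merge : ∀ w → (g 0 ≤ᵇ i) ∧ ((w ≤ᵇ i ∸ g 0) ∧ Y (i ∸ g 0 ∸ w)) ≡ (g 0 + w ≤ᵇ i) ∧ Y (i ∸ (g 0 + w))
  merge w = trans (sym (∧-assoc (g 0 ≤ᵇ i) _ _)) (cong₂ _∧_ (≤ᵇ-∧-≤ᵇ (g 0) w i) (cong Y (∸-+-assoc i (g 0) w)))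

prod₂-applyUpTo : ∀ g n i → prod₂ (applyUpTo g n) i ≡ (⨁[ u ← subsets n ] (weighted g u ≡ᵇ i))
prod₂-applyUpTo g n i = begin
  prod₂ (applyUpTo g n) i        ≡⟨ cong (λ ms → prod₂ ms i) (sym (++-identityʳ (applyUpTo g n))) ⟩
  prod₂ (applyUpTo g n ++ []) i  ≡⟨ prod₂-applyUpTo-++ g n [] i ⟩
  (⨁[ u ← subsets n ] ((weighted g u ≤ᵇ i) ∧ one₂ (i ∸ weighted g u)))
    ≡⟨ ⨁←-cong (subsets n) (λ {u} _ → ≤ᵇ-∧-one (weighted g u) i) ⟩
  (⨁[ u ← subsets n ] (weighted g u ≡ᵇ i)) ∎
  where
  open ≡-Reasoning
  ≤ᵇ-∧-one : ∀ w i → (w ≤ᵇ i) ∧ one₂ (i ∸ w) ≡ (w ≡ᵇ i)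
  ≤ᵇ-∧-one zero    zero    = refl
  ≤ᵇ-∧-one zero    (suc i) = refl
  ≤ᵇ-∧-one (suc w) zero    = refl
  ≤ᵇ-∧-one (suc w) (suc i) = trans (cong (_∧ one₂ (i ∸ w)) (<ᵇ-suc w i)) (≤ᵇ-∧-one w i)

prod₂-applyUpTo-++-applyUpTo : ∀ g n h m i → prod₂ (applyUpTo g n ++ applyUpTo h m) i ≡
                               (⨁[ u ← subsets n ] (⨁[ w ← subsets m ] (weighted g u + weighted h w ≡ᵇ i)))
prod₂-applyUpTo-++-applyUpTo g n h m i = trans (prod₂-applyUpTo-++ g n (applyUpTo h m) i) (⨁←-cong (subsets n) (λ {u} _ → begin
  (weighted g u ≤ᵇ i) ∧ prod₂ (applyUpTo h m) (i ∸ weighted g u)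
    ≡⟨ cong ((weighted g u ≤ᵇ i) ∧_) (prod₂-applyUpTo h m (i ∸ weighted g u)) ⟩
  (weighted g u ≤ᵇ i) ∧ (⨁[ w ← subsets m ] (weighted h w ≡ᵇ i ∸ weighted g u))
    ≡⟨ ⨁←-∧ˡ (subsets m) (weighted g u ≤ᵇ i) (λ w → weighted h w ≡ᵇ i ∸ weighted g u) ⟩
  (⨁[ w ← subsets m ] ((weighted g u ≤ᵇ i) ∧ (weighted h w ≡ᵇ i ∸ weighted g u)))
    ≡⟨ ⨁←-cong (subsets m) (λ {w} _ → ≤ᵇ-∧-≡ᵇ (weighted g u) (weighted h w) i) ⟩
  (⨁[ w ← subsets m ] (weighted g u + weighted h w ≡ᵇ i)) ∎))
  where open ≡-Reasoning

-- Gauss's identity E(q)² = ψ(q) O(q) over 𝔽₂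

-- A configuration (u , v) consists of a set u of parts from {1, …, L} and a set v of parts from
-- {0, …, L}; it has charge |v| - |u| and energy Σ u + Σ v.  This is the combinatorial model of
-- ∏_{n ≥ 1} (1 + z q^n)(1 + z⁻¹ q^{n-1}) truncated at L = N + 1, which suffices up to degree N.
-- charged m W counts the configurations of charge m and energy W, and paired m W the pairs (u , w)
-- of sets of parts from {1, …, L} with |w| = |u| + m and total Σ u + Σ w = W, both modulo 2.
module TripleProduct (N : ℕ) where

  L : ℕ
  L = suc N

  Config : Set
  Config = Vec Bool L × Vec Bool (suc L)

  configs : List Config
  configs = cartesianProduct (subsets L) (subsets (suc L))

  configs-unique : Unique configs
  configs-unique = Uniqueₚ.cartesianProduct⁺ (subsets-unique L) (subsets-unique (suc L))

  ∈-configs : ∀ x → x ∈ configs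
  ∈-configs (u , v) = ∈-cartesianProduct⁺ (∈-subsets u) (∈-subsets v)

  _≟ᵛ_ : ∀ {n} → DecidableEquality (Vec Bool n)
  _≟ᵛ_ = Vecₚ.≡-dec Boolₚ._≟_

  _≟ᶜ_ : DecidableEquality Config
  _≟ᶜ_ = ≡-dec _≟ᵛ_ _≟ᵛ_

  energy : Config → ℕ
  energy (u , v) = weighted suc u + weighted id v

  charge? : ℕ → Config → Bool
  charge? m (u , v) = size v ≡ᵇ size u + m

  charged : ℕ → ℕ → Bool
  charged m W = ⨁[ x ← configs ] (charge? m x ∧ (energy x ≡ᵇ W))

  Pair : Set
  Pair = Vec Bool L × Vec Bool L

  pairs : List Pair
  pairs = cartesianProduct (subsets L) (subsets L)

  total : Pair → ℕ
  total (u , w) = weighted suc u + weighted suc w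

  balance? : ℕ → Pair → Bool
  balance? m (u , w) = size w ≡ᵇ size u + m

  paired : ℕ → ℕ → Bool
  paired m W = ⨁[ x ← pairs ] (balance? m x ∧ (total x ≡ᵇ W))

  low-energy⇒last-absent : ∀ u v → energy (u , v) ≤ N → last u ≡ false × last v ≡ false
  low-energy⇒last-absent u v ≤N =
    last-absent suc u (s≤s (≤-trans (m≤m+n _ _) ≤N)) , last-absent id v (s≤s (≤-trans (m≤n+m _ _) ≤N))

  E⊛E≡⨁pairs : (E ⊛ E) N ≡ (⨁[ x ← pairs ] (total x ≡ᵇ N))
  E⊛E≡⨁pairs = begin
    (E ⊛ E) N
      ≡⟨ ⊛-cong-≈ (limit-≈ positives-growing L) (limit-≈ positives-growing L) N (n≤1+n N) ⟩
    (prod₂ (positives L) ⊛ prod₂ (positives L)) N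
      ≡⟨ sym (prod₂-++ (positives L) (positives L) N) ⟩
    prod₂ (positives L ++ positives L) N
      ≡⟨ cong (λ ms → prod₂ (ms ++ ms) N) (map-applyUpTo id suc L) ⟩
    prod₂ (applyUpTo suc L ++ applyUpTo suc L) N
      ≡⟨ prod₂-applyUpTo-++-applyUpTo suc L suc L N ⟩
    (⨁[ u ← subsets L ] (⨁[ w ← subsets L ] (weighted suc u + weighted suc w ≡ᵇ N)))
      ≡⟨ sym (⨁←-cartesianProduct (subsets L) (subsets L) (λ x → total x ≡ᵇ N)) ⟩
    (⨁[ x ← pairs ] (total x ≡ᵇ N)) ∎
    where open ≡-Reasoning

  -- Exchanging the two sets pairs off all pairs of different sizes.
  ⨁pairs≡paired₀ : (⨁[ x ← pairs ] (total x ≡ᵇ N)) ≡ paired 0 N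
  ⨁pairs≡paired₀ = begin
    sumList pairs P
      ≡⟨ ⨁←-split pairs P (balance? 0) ⟩
    (⨁[ x ← pairs ] (P x ∧ balance? 0 x)) xor sumList pairs P′
      ≡⟨ cong ((⨁[ x ← pairs ] (P x ∧ balance? 0 x)) xor_)
              (⨁←-fixed-point-free _≟ᵖ_ swap P′ pairs-unique involutive fixed-point-free) ⟩
    (⨁[ x ← pairs ] (P x ∧ balance? 0 x)) xor false
      ≡⟨ trans (xor-identityʳ _) (⨁←-cong pairs (λ {x} _ → ∧-comm (P x) (balance? 0 x))) ⟩
    paired 0 N ∎
    where
    open ≡-Reasoning
    P P′ : Pair → Bool
    P x  = total x ≡ᵇ N
    P′ x = P x ∧ not (balance? 0 x)
    _≟ᵖ_ : DecidableEquality Pair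
    _≟ᵖ_ = ≡-dec _≟ᵛ_ _≟ᵛ_
    swap : Pair → Pair
    swap (u , w) = (w , u)
    pairs-unique : Unique pairs
    pairs-unique = Uniqueₚ.cartesianProduct⁺ (subsets-unique L) (subsets-unique L)
    balance-swap : ∀ u w → balance? 0 (w , u) ≡ balance? 0 (u , w)
    balance-swap u w = trans (cong₂ _≡ᵇ_ (sym (+-identityʳ (size u))) (+-identityʳ (size w)))
                             (≡ᵇ-comm (size u + 0) (size w))
    involutive : InvolutiveOn _≟ᵖ_ swap P′ pairs
    involutive {u , w} _ P′x = ∈-cartesianProduct⁺ (∈-subsets w) (∈-subsets u) ,
      trans (cong₂ (λ t b → t ∧ not b) (cong (_≡ᵇ N) (+-comm (weighted suc w) (weighted suc u))) (balance-swap u w)) P′x ,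
      refl
    fixed-point-free : ∀ {x} → x ∈ pairs → P′ x ≡ true → swap x ≢ x
    fixed-point-free {u , w} _ P′x refl =
      contradiction (trans (sym (proj₂ (∧-true P′x))) (cong not (≡ᵇ-true (sym (+-identityʳ (size u)))))) λ ()

  -- Splitting off the part 0 of v.
  charged≡paired : ∀ m W → charged (suc m) W ≡ paired (suc m) W xor paired m W
  charged≡paired m W = begin
    charged (suc m) W
      ≡⟨ ⨁←-cartesianProduct (subsets L) (subsets (suc L)) (λ x → charge? (suc m) x ∧ (energy x ≡ᵇ W)) ⟩
    (⨁[ u ← subsets L ] (⨁[ v ← subsets (suc L) ] (charge? (suc m) (u , v) ∧ (energy (u , v) ≡ᵇ W))))
      ≡⟨ ⨁←-cong (subsets L) (λ {u} _ → trans (⨁←-subsets-suc L (λ v → charge? (suc m) (u , v) ∧ (energy (u , v) ≡ᵇ W)))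
                                              (cong (paired-at (suc m) u xor_) (⨁←-cong (subsets L) (λ {w} _ →
                                                cong (λ c → (suc (size w) ≡ᵇ c) ∧ (total (u , w) ≡ᵇ W)) (+-suc (size u) m))))) ⟩
    (⨁[ u ← subsets L ] (paired-at (suc m) u xor paired-at m u))
      ≡⟨ ⨁←-xor (subsets L) (paired-at (suc m)) (paired-at m) ⟩
    (⨁[ u ← subsets L ] paired-at (suc m) u) xor (⨁[ u ← subsets L ] paired-at m u)
      ≡⟨ sym (cong₂ _xor_ (⨁←-cartesianProduct (subsets L) (subsets L) (λ x → balance? (suc m) x ∧ (total x ≡ᵇ W)))
                          (⨁←-cartesianProduct (subsets L) (subsets L) (λ x → balance? m x ∧ (total x ≡ᵇ W)))) ⟩
    paired (suc m) W xor paired m W ∎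
    where
    open ≡-Reasoning
    paired-at : ℕ → Vec Bool L → Bool
    paired-at k u = ⨁[ w ← subsets L ] (balance? k (u , w) ∧ (total (u , w) ≡ᵇ W))

  paired-large : paired L N ≡ false
  paired-large = ⨁←-false pairs vanishing
    where
    vanishing : ∀ {x} → x ∈ pairs → balance? L x ∧ (total x ≡ᵇ N) ≡ false
    vanishing {u , w} _ with balance? L (u , w) in size≡
    ... | false = refl
    ... | true  = ≡ᵇ-false (λ total≡N → <⇒≱ (s≤s ≤-refl) (begin
      L                ≤⟨ m≤n+m L (size u) ⟩
      size u + L       ≡⟨ sym (≡ᵇ-true⇒≡ size≡) ⟩
      size w           ≤⟨ size≤weighted (λ _ → s≤s z≤n) w ⟩
      weighted suc w   ≤⟨ m≤n+m _ _ ⟩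
      total (u , w)    ≡⟨ total≡N ⟩
      N                ∎))
      where open ≤-Reasoning

  paired₀≡⨁charged : paired 0 N ≡ (⨁[ m < suc N ] charged (suc m) N)
  paired₀≡⨁charged = begin
    paired 0 N                                            ≡⟨ sym (xor-identityʳ _) ⟩
    paired 0 N xor false                                  ≡⟨ cong (paired 0 N xor_) (sym paired-large) ⟩
    paired 0 N xor paired L N                             ≡⟨ sym (⨁<-telescope L (λ m → paired m N)) ⟩
    (⨁[ m < suc N ] (paired m N xor paired (suc m) N))
      ≡⟨ ⨁<-cong L (λ m _ → trans (xor-comm (paired m N) (paired (suc m) N)) (sym (charged≡paired m N))) ⟩
    (⨁[ m < suc N ] charged (suc m) N)                    ∎
    where open ≡-Reasoning

  charged-low-energy : ∀ m W → W < m → charged (suc m) W ≡ false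
  charged-low-energy m W W<m = ⨁←-false configs vanishing
    where
    vanishing : ∀ {x} → x ∈ configs → charge? (suc m) x ∧ (energy x ≡ᵇ W) ≡ false
    vanishing {u , v} _ with charge? (suc m) (u , v) in size≡
    ... | false = refl
    ... | true  = ≡ᵇ-false (λ energy≡W → <⇒≱ W<m (≤-pred (begin
      suc m                  ≤⟨ m≤n+m (suc m) (size u) ⟩
      size u + suc m         ≡⟨ sym (≡ᵇ-true⇒≡ size≡) ⟩
      size v                 ≤⟨ size≤suc-weighted-id v ⟩
      suc (weighted id v)    ≤⟨ s≤s (m≤n+m _ _) ⟩
      suc (energy (u , v))   ≡⟨ cong suc energy≡W ⟩
      suc W                  ∎)))
      where open ≤-Reasoning

  -- Moving every part of u down by one and every part of v up by one; the part 1 of u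
  -- becomes the part 0 of v, with its presence flipped.
  shift : Config → Config
  shift (u₀ ∷ u , v) = u ∷ʳ false , not u₀ ∷ init v

  unshift : Config → Config
  unshift (u , v₀ ∷ v) = not v₀ ∷ init u , v ∷ʳ false

  unshift-shift : ∀ u v → last v ≡ false → unshift (shift (u , v)) ≡ (u , v)
  unshift-shift (u₀ ∷ u) v last≡false = cong₂ _,_ (cong₂ _∷_ (not-involutive u₀) (init-∷ʳ false u)) (init∷ʳfalse v last≡false)

  shift-unshift : ∀ u v → last u ≡ false → shift (unshift (u , v)) ≡ (u , v)
  shift-unshift u (v₀ ∷ v) last≡false = cong₂ _,_ (init∷ʳfalse u last≡false) (cong₂ _∷_ (not-involutive v₀) (init-∷ʳ false v))

  last-unshift : ∀ x → last (proj₂ (unshift x)) ≡ false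
  last-unshift (u , v₀ ∷ v) = last-∷ʳ false v

  shift-size : ∀ u v → last v ≡ false → size (proj₂ (shift (u , v))) + size u ≡ suc (size v + size (proj₁ (shift (u , v))))
  shift-size (u₀ ∷ u) v last≡false = begin
    (select (not u₀) 1 + size (init v)) + (select u₀ 1 + size u)
      ≡⟨ cong₂ (λ x y → (select (not u₀) 1 + x) + (select u₀ 1 + y)) (weighted-init _ v last≡false) (sym (size-∷ʳ-false u)) ⟩
    (select (not u₀) 1 + size v) + (select u₀ 1 + size (u ∷ʳ false))
      ≡⟨ regroup (select (not u₀) 1) (select u₀ 1) (size v) (size (u ∷ʳ false)) ⟩
    (select (not u₀) 1 + select u₀ 1) + (size v + size (u ∷ʳ false))
      ≡⟨ cong (_+ (size v + size (u ∷ʳ false))) (select-not+select u₀) ⟩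
    suc (size v + size (u ∷ʳ false)) ∎
    where
    open ≡-Reasoning
    regroup : ∀ a b c d → (a + c) + (b + d) ≡ (a + b) + (c + d)
    regroup = solve-∀

  shift-energy : ∀ u v → last v ≡ false → energy (shift (u , v)) + size u ≡ energy (u , v) + size v
  shift-energy (u₀ ∷ u) v last≡false = begin
    (weighted suc (u ∷ʳ false) + (select (not u₀) 0 + weighted suc (init v))) + (select u₀ 1 + size u)
      ≡⟨ cong₂ (λ x y → (x + y) + (select u₀ 1 + size u))
               (trans (weighted-∷ʳ suc u false) (+-identityʳ _))
               (cong₂ _+_ (select-zero (not u₀))
                          (trans (weighted-suc (init v))
                                 (cong₂ _+_ (weighted-init id v last≡false) (weighted-init _ v last≡false)))) ⟩
    (weighted suc u + (weighted id v + size v)) + (select u₀ 1 + size u)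
      ≡⟨ regroup (weighted suc u) (weighted id v) (size v) (select u₀ 1) (size u) ⟩
    (select u₀ 1 + (weighted suc u + size u) + weighted id v) + size v
      ≡⟨ cong (λ x → (select u₀ 1 + x + weighted id v) + size v) (sym (weighted-shift suc u)) ⟩
    energy (u₀ ∷ u , v) + size v ∎
    where
    open ≡-Reasoning
    select-zero : ∀ b → select b 0 ≡ 0
    select-zero true  = refl
    select-zero false = refl
    regroup : ∀ a b c d e → (a + (b + c)) + (d + e) ≡ (d + (a + e) + b) + c
    regroup = solve-∀

  charge-exclusive : ∀ m x → charge? (suc m) x ≡ true → charge? m x ≡ false
  charge-exclusive m (u , v) size≡suc = ≡ᵇ-false λ size≡ →
    1+n≢n (trans (sym (+-suc (size u) m)) (trans (sym (≡ᵇ-true⇒≡ {size v} size≡suc)) size≡))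

  charge-exclusive′ : ∀ m x → charge? m x ≡ true → charge? (suc m) x ≡ false
  charge-exclusive′ m x size≡ with charge? (suc m) x in size≡suc
  ... | false = refl
  ... | true  = contradiction (trans (sym size≡) (charge-exclusive m x size≡suc)) λ ()

  shift-charged : ∀ {m W} u v → last v ≡ false → size v ≡ size u + m → energy (u , v) ≡ W →
                  charge? (suc m) (shift (u , v)) ≡ true × energy (shift (u , v)) ≡ W + m
  shift-charged {m} {W} u v last≡false size≡ energy≡ =
    ≡ᵇ-true (+-cancelʳ-≡ (size u) _ _ (trans (shift-size u v last≡false)
      (trans (cong (λ s → suc (s + size u′)) size≡) (regroup₁ (size u) m (size u′))))) ,
    +-cancelʳ-≡ (size u) _ _ (trans (shift-energy u v last≡false)
      (trans (cong₂ _+_ energy≡ size≡) (regroup₂ W (size u) m)))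
    where
    u′ = proj₁ (shift (u , v))
    regroup₁ : ∀ a b c → suc (a + b + c) ≡ c + suc b + a
    regroup₁ = solve-∀
    regroup₂ : ∀ a b c → a + (b + c) ≡ a + c + b
    regroup₂ = solve-∀

  unshift-charged : ∀ {m W} u v → last u ≡ false → size v ≡ size u + suc m → energy (u , v) ≡ W + m →
                    charge? m (unshift (u , v)) ≡ true × energy (unshift (u , v)) ≡ W
  unshift-charged {m} {W} u v last≡false size≡ energy≡ = ≡ᵇ-true size′ , energy′
    where
    y = unshift (u , v)
    shift-y = shift-unshift u v last≡false
    size′ : size (proj₂ y) ≡ size (proj₁ y) + m
    size′ = suc-injective (+-cancelʳ-≡ (size u) _ _ (begin
      suc (size (proj₂ y) + size u)
        ≡⟨ sym (subst (λ z → size (proj₂ z) + size (proj₁ y) ≡ suc (size (proj₂ y) + size (proj₁ z))) shift-y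
                      (shift-size (proj₁ y) (proj₂ y) (last-unshift (u , v)))) ⟩
      size v + size (proj₁ y)           ≡⟨ cong (_+ size (proj₁ y)) size≡ ⟩
      size u + suc m + size (proj₁ y)   ≡⟨ regroup₁ (size u) m (size (proj₁ y)) ⟩
      suc (size (proj₁ y) + m + size u) ∎))
      where
      open ≡-Reasoning
      regroup₁ : ∀ a b c → a + suc b + c ≡ suc (c + b + a)
      regroup₁ = solve-∀
    energy′ : energy y ≡ W
    energy′ = +-cancelʳ-≡ (size (proj₁ y) + m) _ _ (begin
      energy y + (size (proj₁ y) + m)   ≡⟨ cong (energy y +_) (sym size′) ⟩
      energy y + size (proj₂ y)
        ≡⟨ sym (subst (λ z → energy z + size (proj₁ y) ≡ energy y + size (proj₂ y)) shift-y
                      (shift-energy (proj₁ y) (proj₂ y) (last-unshift (u , v)))) ⟩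
      energy (u , v) + size (proj₁ y)   ≡⟨ cong (_+ size (proj₁ y)) energy≡ ⟩
      W + m + size (proj₁ y)            ≡⟨ regroup₂ W m (size (proj₁ y)) ⟩
      W + (size (proj₁ y) + m)          ∎)
      where
      open ≡-Reasoning
      regroup₂ : ∀ a b c → a + b + c ≡ a + (c + b)
      regroup₂ = solve-∀

  -- shift and unshift are inverse bijections between the configurations counted by the two sides
  charged-shift : ∀ m W → W + m ≤ N → charged (suc m) (W + m) ≡ charged m W
  charged-shift m W ≤N = xor-cancelʳ (charged m W) (begin
    charged (suc m) (W + m) xor charged m W   ≡⟨ sym (⨁←-xor configs P₁ P₀) ⟩
    sumList configs P                        ≡⟨ ⨁←-fixed-point-free _≟ᶜ_ ι P configs-unique
                                                  (λ _ Px → proj₁ (partner _ Px)) (λ _ Px → proj₂ (partner _ Px)) ⟩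
    false                                    ≡⟨ sym (xor-same (charged m W)) ⟩
    charged m W xor charged m W              ∎)
    where
    open ≡-Reasoning
    P₁ P₀ P : Config → Bool
    P₁ x = charge? (suc m) x ∧ (energy x ≡ᵇ W + m)
    P₀ x = charge? m x ∧ (energy x ≡ᵇ W)
    P x  = P₁ x xor P₀ x
    ι : Config → Config
    ι x = if charge? m x then shift x else unshift x
    ι-by-charge : ∀ x {b} → charge? m x ≡ b → ι x ≡ (if b then shift x else unshift x)
    ι-by-charge x c = cong (λ b → if b then shift x else unshift x) c
    partner : ∀ x → P x ≡ true → (ι x ∈ configs × P (ι x) ≡ true × ι (ι x) ≡ x) × ι x ≢ x
    partner (u , v) Px with P₀ (u , v) in P₀≡
    ... | true = (∈-configs _ , Py , trans (cong ι ιx≡y) (trans (ι-by-charge y cy) (unshift-shift u v last-v))) ,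
                 λ ιx≡x → contradiction (trans (sym c₀) (trans (cong (charge? m) (sym (trans (sym ιx≡y) ιx≡x))) cy)) λ ()
      where
      c₀ = proj₁ (∧-true {charge? m (u , v)} P₀≡)
      e₀ = ≡ᵇ-true⇒≡ {energy (u , v)} (proj₂ (∧-true {charge? m (u , v)} P₀≡))
      last-v = proj₂ (low-energy⇒last-absent u v (≤-trans (≤-reflexive e₀) (≤-trans (m≤m+n W m) ≤N)))
      y = shift (u , v)
      ιx≡y = ι-by-charge (u , v) c₀
      y-charged = shift-charged u v last-v (≡ᵇ-true⇒≡ c₀) e₀
      cy = charge-exclusive m y (proj₁ y-charged)
      Py : P (ι (u , v)) ≡ true
      Py = trans (cong P ιx≡y) (cong₂ _xor_ (cong₂ _∧_ (proj₁ y-charged) (≡ᵇ-true (proj₂ y-charged)))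
                                             (cong (_∧ (energy y ≡ᵇ W)) cy))
    ... | false = (∈-configs _ , Py , trans (cong ι ιx≡y) (trans (ι-by-charge y cy) (shift-unshift u v last-u))) ,
                  λ ιx≡x → contradiction (trans (sym cy) (trans (cong (charge? m) (trans (sym ιx≡y) ιx≡x)) cx)) λ ()
      where
      P₁≡ = trans (sym (xor-identityʳ (P₁ (u , v)))) Px
      c₁ = proj₁ (∧-true {charge? (suc m) (u , v)} P₁≡)
      e₁ = ≡ᵇ-true⇒≡ {energy (u , v)} (proj₂ (∧-true {charge? (suc m) (u , v)} P₁≡))
      last-u = proj₁ (low-energy⇒last-absent u v (≤-trans (≤-reflexive e₁) ≤N))
      cx = charge-exclusive m (u , v) c₁
      y = unshift (u , v)
      ιx≡y = ι-by-charge (u , v) cx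
      y-charged = unshift-charged u v last-u (≡ᵇ-true⇒≡ c₁) e₁
      cy = proj₁ y-charged
      Py : P (ι (u , v)) ≡ true
      Py = trans (cong P ιx≡y) (cong₂ _xor_ (cong (_∧ (energy y ≡ᵇ W + m)) (charge-exclusive′ m y cy))
                                             (cong₂ _∧_ cy (≡ᵇ-true (proj₂ y-charged))))

  charged-triangle : ∀ m W → W ≤ N → charged (suc m) W ≡ (triangle m ≤ᵇ W) ∧ charged 0 (W ∸ triangle m)
  charged-triangle zero    W W≤N = trans (cong (charged 1) (sym (+-identityʳ W)))
                                         (charged-shift 0 W (≤-trans (≤-reflexive (+-identityʳ W)) W≤N))
  charged-triangle (suc m) W W≤N with suc m ≤? W
  ... | no  W<1+m = trans (charged-low-energy (suc m) W (≰⇒> W<1+m))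
                          (sym (cong (_∧ charged 0 (W ∸ triangle (suc m)))
                                     (≤ᵇ-false (≤-trans (≰⇒> W<1+m) (m≤n+m (suc m) (triangle m))))))
  ... | yes 1+m≤W = begin
    charged (suc (suc m)) W
      ≡⟨ cong (charged (suc (suc m))) (sym (m∸n+n≡m 1+m≤W)) ⟩
    charged (suc (suc m)) (W ∸ suc m + suc m)
      ≡⟨ charged-shift (suc m) (W ∸ suc m) (≤-trans (≤-reflexive (m∸n+n≡m 1+m≤W)) W≤N) ⟩
    charged (suc m) (W ∸ suc m)
      ≡⟨ charged-triangle m (W ∸ suc m) (≤-trans (m∸n≤m W (suc m)) W≤N) ⟩
    (triangle m ≤ᵇ W ∸ suc m) ∧ charged 0 (W ∸ suc m ∸ triangle m)
      ≡⟨ cong₂ _∧_ (trans (cong (_∧ (triangle m ≤ᵇ W ∸ suc m)) (sym (≤ᵇ-true 1+m≤W)))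
                          (≤ᵇ-∧-≤ᵇ (suc m) (triangle m) W))
                   (cong (charged 0) (∸-+-assoc W (suc m) (triangle m))) ⟩
    (suc m + triangle m ≤ᵇ W) ∧ charged 0 (W ∸ (suc m + triangle m))
      ≡⟨ cong (λ t → (t ≤ᵇ W) ∧ charged 0 (W ∸ t)) (+-comm (suc m) (triangle m)) ⟩
    (triangle (suc m) ≤ᵇ W) ∧ charged 0 (W ∸ triangle (suc m)) ∎
    where open ≡-Reasoning

  -- Exchanging u and v, with the parts of v moved up and those of u moved down, preserves charge 0
  -- and the energy; the fixed points (u , u - 1) have energy Σ_{j ∈ u} (2j - 1).
  reflect : Config → Config
  reflect (u , v) = init v , u ∷ʳ false

  reflect-fixed : ∀ u v → does (reflect (u , v) ≟ᶜ (u , v)) ≡ does (v ≟ᵛ (u ∷ʳ false))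
  reflect-fixed u v with reflect (u , v) ≟ᶜ (u , v) | v ≟ᵛ (u ∷ʳ false)
  ... | yes fixed | yes _    = refl
  ... | no  _     | no  _    = refl
  ... | yes fixed | no v≢u₀  = contradiction (sym (cong proj₂ fixed)) v≢u₀
  ... | no  ¬fixed | yes refl = contradiction (cong (_, u ∷ʳ false) (init-∷ʳ false u)) ¬fixed

  reflect-involutive : ∀ W → W ≤ N → InvolutiveOn _≟ᶜ_ reflect (λ x → charge? 0 x ∧ (energy x ≡ᵇ W)) configs
  reflect-involutive W W≤N {u , v} _ P₀≡ =
    ∈-configs _ , cong₂ _∧_ (≡ᵇ-true size′) (≡ᵇ-true energy′) , cong₂ _,_ (init-∷ʳ false u) (init∷ʳfalse v last-v)
    where
    size≡ = trans (≡ᵇ-true⇒≡ (proj₁ (∧-true P₀≡))) (+-identityʳ (size u))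
    energy≡ = ≡ᵇ-true⇒≡ (proj₂ (∧-true P₀≡))
    last-v = proj₂ (low-energy⇒last-absent u v (≤-trans (≤-reflexive energy≡) W≤N))
    size′ : size (u ∷ʳ false) ≡ size (init v) + 0
    size′ = trans (size-∷ʳ-false u) (trans (sym size≡) (trans (sym (weighted-init _ v last-v)) (sym (+-identityʳ _))))
    energy′ : energy (reflect (u , v)) ≡ W
    energy′ = begin
      weighted suc (init v) + weighted id (u ∷ʳ false)
        ≡⟨ cong₂ _+_ (trans (weighted-suc (init v)) (cong₂ _+_ (weighted-init id v last-v) (weighted-init _ v last-v)))
                     (trans (weighted-∷ʳ id u false) (+-identityʳ _)) ⟩
      weighted id v + size v + weighted id u      ≡⟨ cong (λ s → weighted id v + s + weighted id u) size≡ ⟩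
      weighted id v + size u + weighted id u      ≡⟨ regroup (weighted id v) (size u) (weighted id u) ⟩
      (weighted id u + size u) + weighted id v    ≡⟨ cong (_+ weighted id v) (sym (weighted-suc u)) ⟩
      energy (u , v)                              ≡⟨ energy≡ ⟩
      W                                           ∎
      where
      open ≡-Reasoning
      regroup : ∀ a b c → a + b + c ≡ c + b + a
      regroup = solve-∀

  energy-fixed : ∀ u → energy (u , u ∷ʳ false) ≡ weighted (λ j → 2 * j + 1) u
  energy-fixed u = begin
    weighted suc u + weighted id (u ∷ʳ false)  ≡⟨ cong (weighted suc u +_) (trans (weighted-∷ʳ id u false) (+-identityʳ _)) ⟩
    weighted suc u + weighted id u             ≡⟨ sym (weighted-+ suc id u) ⟩
    weighted (λ j → suc j + j) u               ≡⟨ weighted-cong (λ j → 1+j+j j) u ⟩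
    weighted (λ j → 2 * j + 1) u               ∎
    where
    open ≡-Reasoning
    1+j+j : ∀ j → suc j + j ≡ 2 * j + 1
    1+j+j = solve-∀

  charged₀≡odd-parts : ∀ W → W ≤ N → charged 0 W ≡ prod₂ (odds L) W
  charged₀≡odd-parts W W≤N = begin
    charged 0 W
      ≡⟨ ⨁←-involution _≟ᶜ_ reflect P₀ configs-unique (reflect-involutive W W≤N) ⟩
    (⨁[ x ← configs ] (P₀ x ∧ does (reflect x ≟ᶜ x)))
      ≡⟨ ⨁←-cartesianProduct (subsets L) (subsets (suc L)) (λ x → P₀ x ∧ does (reflect x ≟ᶜ x)) ⟩
    (⨁[ u ← subsets L ] (⨁[ v ← subsets (suc L) ] (P₀ (u , v) ∧ does (reflect (u , v) ≟ᶜ (u , v)))))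
      ≡⟨ ⨁←-cong (subsets L) (λ {u} _ → trans (⨁←-cong (subsets (suc L)) (λ {v} _ → cong (P₀ (u , v) ∧_) (reflect-fixed u v)))
                                              (⨁←-indicator _≟ᵛ_ (λ v → P₀ (u , v)) (subsets-unique (suc L))
                                                                  (∈-subsets (u ∷ʳ false)))) ⟩
    (⨁[ u ← subsets L ] P₀ (u , u ∷ʳ false))
      ≡⟨ ⨁←-cong (subsets L) (λ {u} _ → cong₂ _∧_ (≡ᵇ-true (trans (size-∷ʳ-false u) (sym (+-identityʳ (size u)))))
                                                 (cong (_≡ᵇ W) (energy-fixed u))) ⟩
    (⨁[ u ← subsets L ] (weighted (λ j → 2 * j + 1) u ≡ᵇ W))
      ≡⟨ sym (trans (cong (λ ms → prod₂ ms W) (map-applyUpTo id (λ j → 2 * j + 1) L))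
                    (prod₂-applyUpTo (λ j → 2 * j + 1) L W)) ⟩
    prod₂ (odds L) W ∎
    where
    open ≡-Reasoning
    P₀ : Config → Bool
    P₀ x = charge? 0 x ∧ (energy x ≡ᵇ W)

E⊛E≗ψ⊛O : E ⊛ E ≗ ψ ⊛ O
E⊛E≗ψ⊛O N = begin
  (E ⊛ E) N                                                   ≡⟨ E⊛E≡⨁pairs ⟩
  (⨁[ x ← pairs ] (total x ≡ᵇ N))                             ≡⟨ ⨁pairs≡paired₀ ⟩
  paired 0 N                                                  ≡⟨ paired₀≡⨁charged ⟩
  (⨁[ m < suc N ] charged (suc m) N)                          ≡⟨ ⨁<-cong (suc N) (λ m _ → charged-odd-parts m) ⟩
  (⨁[ m < suc N ] ((triangle m ≤ᵇ N) ∧ O (N ∸ triangle m)))   ≡⟨ sym (seriesOf-⊛ triangle a≤triangle[a] O N) ⟩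
  (ψ ⊛ O) N                                                   ∎
  where
  open ≡-Reasoning
  open TripleProduct N
  charged-odd-parts : ∀ m → charged (suc m) N ≡ (triangle m ≤ᵇ N) ∧ O (N ∸ triangle m)
  charged-odd-parts m = trans (charged-triangle m N ≤-refl) (cong ((triangle m ≤ᵇ N) ∧_)
    (trans (charged₀≡odd-parts (N ∸ triangle m) (m∸n≤m N (triangle m)))
           (sym (limit-≈ odds-growing L (N ∸ triangle m) (≤-trans (m∸n≤m N (triangle m)) (n≤1+n N))))))

-- Pairs of triangular numbers: the coefficients of ψ(q) ψ(q³)

weight : ℕ × ℕ → ℕ
weight (a , b) = triangle a + triangle b * 3

weight-double : ∀ a b → weight (a , b) * 2 ≡ a * suc a + b * suc b * 3
weight-double a b = begin
  (triangle a + triangle b * 3) * 2       ≡⟨ regroup (triangle a) (triangle b) ⟩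
  triangle a * 2 + triangle b * 2 * 3     ≡⟨ cong₂ (λ x y → x + y * 3) (triangle-double a) (triangle-double b) ⟩
  a * suc a + b * suc b * 3               ∎
  where
  open ≡-Reasoning
  regroup : ∀ x y → (x + y * 3) * 2 ≡ x * 2 + y * 2 * 3
  regroup = solve-∀

weight-cong : ∀ a b a′ b′ → a′ * suc a′ + b′ * suc b′ * 3 ≡ a * suc a + b * suc b * 3 →
              weight (a′ , b′) ≡ weight (a , b)
weight-cong a b a′ b′ eq = *-cancelʳ-≡ _ _ 2 (trans (weight-double a′ b′) (trans eq (sym (weight-double a b))))

isEven : ℕ → Bool
isEven zero    = true
isEven (suc n) = not (isEven n)

isEven-even : ∀ k → isEven (k * 2) ≡ true
isEven-even zero    = refl
isEven-even (suc k) = trans (not-involutive _) (isEven-even k)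

isEven-odd : ∀ k → isEven (suc (k * 2)) ≡ false
isEven-odd k = cong not (isEven-even k)

⌊even/2⌋ : ∀ k → ⌊ k * 2 /2⌋ ≡ k
⌊even/2⌋ zero    = refl
⌊even/2⌋ (suc k) = cong suc (⌊even/2⌋ k)

⌊odd/2⌋ : ∀ k → ⌊ suc (k * 2) /2⌋ ≡ k
⌊odd/2⌋ zero    = refl
⌊odd/2⌋ (suc k) = cong suc (⌊odd/2⌋ k)

-- With X = 2a + 1 and Y = 2b + 1 one has X² + 3Y² = 8 · weight (a , b) + 4.  rotate multiplies
-- X + Y√-3 by the root of unity (1 ± √-3)/2 that keeps both coordinates odd and takes absolute values.
rotate′ : Bool → ℕ → ℕ → ℕ × ℕ
rotate′ true  a b = ⌊ ∣ a - suc (b * 3) ∣ /2⌋ , ⌊ a + b /2⌋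
rotate′ false a b = ⌊ a + suc (b * 3) /2⌋ , ⌊ ∣ a - b ∣ /2⌋

rotate : ℕ × ℕ → ℕ × ℕ
rotate (a , b) = rotate′ (isEven (a + b)) a b

rotate-even : ∀ {a b} a′ b′ → a + b ≡ b′ * 2 → ∣ a - suc (b * 3) ∣ ≡ suc (a′ * 2) → rotate (a , b) ≡ (a′ , b′)
rotate-even {a} {b} a′ b′ a+b≡ ∣a-3b-1∣≡ = begin
  rotate′ (isEven (a + b)) a b                        ≡⟨ cong (λ e → rotate′ e a b) (trans (cong isEven a+b≡) (isEven-even b′)) ⟩
  (⌊ ∣ a - suc (b * 3) ∣ /2⌋ , ⌊ a + b /2⌋)          ≡⟨ cong₂ _,_ (trans (cong ⌊_/2⌋ ∣a-3b-1∣≡) (⌊odd/2⌋ a′))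
                                                                   (trans (cong ⌊_/2⌋ a+b≡) (⌊even/2⌋ b′)) ⟩
  (a′ , b′)                                           ∎
  where open ≡-Reasoning

rotate-odd : ∀ {a b} c a′ b′ → a + b ≡ suc (c * 2) → a + suc (b * 3) ≡ a′ * 2 → ∣ a - b ∣ ≡ suc (b′ * 2) →
             rotate (a , b) ≡ (a′ , b′)
rotate-odd {a} {b} c a′ b′ a+b≡ a+3b+1≡ ∣a-b∣≡ = begin
  rotate′ (isEven (a + b)) a b                        ≡⟨ cong (λ e → rotate′ e a b) (trans (cong isEven a+b≡) (isEven-odd c)) ⟩
  (⌊ a + suc (b * 3) /2⌋ , ⌊ ∣ a - b ∣ /2⌋)          ≡⟨ cong₂ _,_ (trans (cong ⌊_/2⌋ a+3b+1≡) (⌊even/2⌋ a′))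
                                                                   (trans (cong ⌊_/2⌋ ∣a-b∣≡) (⌊odd/2⌋ b′)) ⟩
  (a′ , b′)                                           ∎
  where open ≡-Reasoning

∣m+n-m∣≡n : ∀ m n → ∣ m + n - m ∣ ≡ n
∣m+n-m∣≡n m n = trans (∣-∣-comm (m + n) m) (∣m-m+n∣≡n m n)

-- Every pair has one of the following shapes; rotate exchanges below ↔ near,
-- far ↔ below-odd, and maps above-odd to itself.
data Shape : ℕ → ℕ → Set where
  below     : ∀ a k → Shape a (a + k * 2)
  near      : ∀ j k → Shape (j + k * 3) (j + k)
  far       : ∀ b p → Shape (b * 3 + suc (suc (p * 2))) b
  below-odd : ∀ a k → Shape a (a + suc (k * 2))
  above-odd : ∀ b k → Shape (b + suc (k * 2)) b

shape : ∀ a b → Shape a b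
shape a b with a ≤? b
... | yes a≤b with m≤n⇒∃[o]m+o≡n a≤b
...   | d , refl with parityView d
...     | even k = below a k
...     | odd k  = below-odd a k
shape a b | no a≰b with m≤n⇒∃[o]m+o≡n (≰⇒> a≰b)
...   | d , refl with parityView d
...     | even k = subst (λ x → Shape x b) (+-suc b (k * 2)) (above-odd b k)
...     | odd k with suc k ≤? b
...       | yes k<b with m≤n⇒∃[o]m+o≡n k<b
...         | j , refl = subst₂ Shape (shift j k) (+-comm j (suc k)) (near j (suc k))
  where
  shift : ∀ j k → j + suc k * 3 ≡ suc (suc k + j + suc (k * 2))
  shift = solve-∀
shape a b | no a≰b | d , refl | odd k | no k≮b with m≤n⇒∃[o]m+o≡n (≰⇒> k≮b)
...         | p , refl = subst (λ x → Shape x b) (shift b p) (far b p)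
  where
  shift : ∀ b p → b * 3 + suc (suc (p * 2)) ≡ suc (b + suc ((b + p) * 2))
  shift = solve-∀

rotate-below : ∀ a k → rotate (a , a + k * 2) ≡ (a + k * 3 , a + k)
rotate-below a k = rotate-even (a + k * 3) (a + k) (sum a k)
  (trans (cong (∣ a -_∣) (diff a k)) (∣m-m+n∣≡n a _))
  where
  sum : ∀ a k → a + (a + k * 2) ≡ (a + k) * 2
  sum = solve-∀
  diff : ∀ a k → suc ((a + k * 2) * 3) ≡ a + suc ((a + k * 3) * 2)
  diff = solve-∀

rotate-near : ∀ j k → rotate (j + k * 3 , j + k) ≡ (j , j + k * 2)
rotate-near j k = rotate-even j (j + k * 2) (sum j k)
  (trans (cong (∣ j + k * 3 -_∣) (diff j k)) (∣m-m+n∣≡n (j + k * 3) _))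
  where
  sum : ∀ j k → j + k * 3 + (j + k) ≡ (j + k * 2) * 2
  sum = solve-∀
  diff : ∀ j k → suc ((j + k) * 3) ≡ j + k * 3 + suc (j * 2)
  diff = solve-∀

rotate-far : ∀ b p → rotate (b * 3 + suc (suc (p * 2)) , b) ≡ (p , p + suc (b * 2))
rotate-far b p = rotate-even p (p + suc (b * 2)) (sum b p)
  (trans (cong (∣_- suc (b * 3) ∣) (diff b p)) (∣m+n-m∣≡n (suc (b * 3)) _))
  where
  sum : ∀ b p → b * 3 + suc (suc (p * 2)) + b ≡ (p + suc (b * 2)) * 2
  sum = solve-∀
  diff : ∀ b p → b * 3 + suc (suc (p * 2)) ≡ suc (b * 3) + suc (p * 2)
  diff = solve-∀

rotate-below-odd : ∀ a k → rotate (a , a + suc (k * 2)) ≡ (k * 3 + suc (suc (a * 2)) , k)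
rotate-below-odd a k = rotate-odd (a + k) (k * 3 + suc (suc (a * 2))) k (sum a k) (sum′ a k) (∣m-m+n∣≡n a _)
  where
  sum : ∀ a k → a + (a + suc (k * 2)) ≡ suc ((a + k) * 2)
  sum = solve-∀
  sum′ : ∀ a k → a + suc ((a + suc (k * 2)) * 3) ≡ (k * 3 + suc (suc (a * 2))) * 2
  sum′ = solve-∀

rotate-above-odd : ∀ b k → rotate (b + suc (k * 2) , b) ≡ (k + suc (b * 2) , k)
rotate-above-odd b k = rotate-odd (b + k) (k + suc (b * 2)) k (sum b k) (sum′ b k) (∣m+n-m∣≡n b _)
  where
  sum : ∀ b k → b + suc (k * 2) + b ≡ suc ((b + k) * 2)
  sum = solve-∀
  sum′ : ∀ b k → b + suc (k * 2) + suc (b * 3) ≡ (k + suc (b * 2)) * 2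
  sum′ = solve-∀

rotate-involutive : ∀ {a b} → Shape a b → rotate (rotate (a , b)) ≡ (a , b)
rotate-involutive (below a k)     = trans (cong rotate (rotate-below a k)) (rotate-near a k)
rotate-involutive (near j k)      = trans (cong rotate (rotate-near j k)) (rotate-below j k)
rotate-involutive (far b p)       = trans (cong rotate (rotate-far b p)) (rotate-below-odd p b)
rotate-involutive (below-odd a k) = trans (cong rotate (rotate-below-odd a k)) (rotate-far k a)
rotate-involutive (above-odd b k) = trans (cong rotate (rotate-above-odd b k)) (rotate-above-odd k b)

rotate-weight : ∀ {a b} → Shape a b → weight (rotate (a , b)) ≡ weight (a , b)
rotate-weight (below a k)     rewrite rotate-below a k     = weight-cong a (a + k * 2) (a + k * 3) (a + k) (identity a k)
  where
  identity : ∀ a k → (a + k * 3) * suc (a + k * 3) + (a + k) * suc (a + k) * 3 ≡ a * suc a + (a + k * 2) * suc (a + k * 2) * 3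
  identity = solve-∀
rotate-weight (near j k)      rewrite rotate-near j k      = weight-cong (j + k * 3) (j + k) j (j + k * 2) (identity j k)
  where
  identity : ∀ j k → j * suc j + (j + k * 2) * suc (j + k * 2) * 3 ≡ (j + k * 3) * suc (j + k * 3) + (j + k) * suc (j + k) * 3
  identity = solve-∀
rotate-weight (far b p)       rewrite rotate-far b p       = weight-cong (b * 3 + suc (suc (p * 2))) b p (p + suc (b * 2)) (identity b p)
  where
  identity : ∀ b p → p * suc p + (p + suc (b * 2)) * suc (p + suc (b * 2)) * 3
                   ≡ (b * 3 + suc (suc (p * 2))) * suc (b * 3 + suc (suc (p * 2))) + b * suc b * 3
  identity = solve-∀
rotate-weight (below-odd a k) rewrite rotate-below-odd a k = weight-cong a (a + suc (k * 2)) (k * 3 + suc (suc (a * 2))) k (identity a k)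
  where
  identity : ∀ a k → (k * 3 + suc (suc (a * 2))) * suc (k * 3 + suc (suc (a * 2))) + k * suc k * 3
                   ≡ a * suc a + (a + suc (k * 2)) * suc (a + suc (k * 2)) * 3
  identity = solve-∀
rotate-weight (above-odd b k) rewrite rotate-above-odd b k = weight-cong (b + suc (k * 2)) b (k + suc (b * 2)) k (identity b k)
  where
  identity : ∀ b k → (k + suc (b * 2)) * suc (k + suc (b * 2)) + k * suc k * 3
                   ≡ (b + suc (k * 2)) * suc (b + suc (k * 2)) + b * suc b * 3
  identity = solve-∀

diagonal : ∀ a → weight (a , a + 0) % 4 ≡ 0
diagonal a rewrite +-identityʳ a = trans (cong (_% 4) (four-times (triangle a))) (m*n%n≡0 (triangle a) 4)
  where
  four-times : ∀ t → t + t * 3 ≡ t * 4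
  four-times = solve-∀

rotate-fixed : ∀ {a b} → Shape a b → rotate (a , b) ≡ (a , b) → weight (a , b) % 4 ≡ 0 ⊎ weight (a , b) % 4 ≡ 1
rotate-fixed (below a zero)        _     = inj₁ (diagonal a)
rotate-fixed (below a (suc k))     fixed = contradiction (trans (sym (cong proj₁ (trans (sym (rotate-below a (suc k))) fixed)))
                                                              (+-suc a _)) (m≢1+m+n a)
rotate-fixed (near j zero)         _     = inj₁ (subst (λ x → weight (x , j + 0) % 4 ≡ 0) (sym (+-identityʳ j)) (diagonal j))
rotate-fixed (near j (suc k))      fixed = contradiction (trans (cong proj₁ (trans (sym (rotate-near j (suc k))) fixed))
                                                              (+-suc j _)) (m≢1+m+n j)
rotate-fixed (far b p)             fixed = contradiction (trans (cong proj₁ (trans (sym (rotate-far b p)) fixed)) (shift b p)) (m≢1+n+m p)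
  where
  shift : ∀ b p → b * 3 + suc (suc (p * 2)) ≡ suc (suc (b * 3 + p) + p)
  shift = solve-∀
rotate-fixed (below-odd a k)       fixed =
  contradiction (trans (sym (cong proj₁ (trans (sym (rotate-below-odd a k)) fixed))) (shift a k)) (m≢1+n+m a)
  where
  shift : ∀ a k → k * 3 + suc (suc (a * 2)) ≡ suc (suc (k * 3 + a) + a)
  shift = solve-∀
rotate-fixed (above-odd b k)       fixed = inj₂ (off-diagonal (cong proj₂ (trans (sym (rotate-above-odd b k)) fixed)))
  where
  off-diagonal : k ≡ b → weight (b + suc (k * 2) , b) % 4 ≡ 1
  off-diagonal refl = trans (cong (_% 4) (weight≡ k)) ([m+kn]%n≡m%n 1 (triangle k * 3) 4)
    where
    weight≡ : ∀ b → weight (b + suc (b * 2) , b) ≡ 1 + triangle b * 3 * 4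
    weight≡ b = *-cancelʳ-≡ _ _ 2 (begin
      weight (b + suc (b * 2) , b) * 2                        ≡⟨ weight-double (b + suc (b * 2)) b ⟩
      (b + suc (b * 2)) * suc (b + suc (b * 2)) + b * suc b * 3 ≡⟨ expand b ⟩
      2 + b * suc b * 12                                      ≡⟨ cong (λ x → 2 + x * 12) (sym (triangle-double b)) ⟩
      2 + triangle b * 2 * 12                                 ≡⟨ regroup (triangle b) ⟩
      (1 + triangle b * 3 * 4) * 2                            ∎)
      where
      open ≡-Reasoning
      expand : ∀ b → (b + suc (b * 2)) * suc (b + suc (b * 2)) + b * suc b * 3 ≡ 2 + b * suc b * 12
      expand = solve-∀
      regroup : ∀ t → 2 + t * 2 * 12 ≡ (1 + t * 3 * 4) * 2
      regroup = solve-∀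

ψ⊛ψ[q³]≡⨁weight : ∀ N → (ψ ⊛ dilate 3 ψ) N ≡ (⨁[ ab ← cartesianProduct (upTo (suc N)) (upTo (suc N)) ] (weight ab ≡ᵇ N))
ψ⊛ψ[q³]≡⨁weight N = trans (⊛-congˡ ψ (dilate-seriesOf triangle a≤triangle[a] 3) N)
  (seriesOf-⊛-seriesOf triangle (λ b → triangle b * 3) a≤triangle[a] (λ b → ≤-trans (a≤triangle[a] b) (m≤m*n (triangle b) 3)) N)

≡2∨3⇒<4 : ∀ {r} → r ≡ 2 ⊎ r ≡ 3 → r < 4
≡2∨3⇒<4 (inj₁ refl) = s≤s (s≤s (s≤s z≤n))
≡2∨3⇒<4 (inj₂ refl) = s≤s (s≤s (s≤s (s≤s z≤n)))

ψ⊛ψ[q³]-vanishes : ∀ m r → r ≡ 2 ⊎ r ≡ 3 → (ψ ⊛ dilate 3 ψ) (m * 4 + r) ≡ false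
ψ⊛ψ[q³]-vanishes m r r≡2∨3 = trans (ψ⊛ψ[q³]≡⨁weight N)
  (⨁←-fixed-point-free (≡-dec _≟_ _≟_) rotate (λ ab → weight ab ≡ᵇ N) pairs-unique involutive fixed-point-free)
  where
  N = m * 4 + r
  pairs = cartesianProduct (upTo (suc N)) (upTo (suc N))
  pairs-unique : Unique pairs
  pairs-unique = Uniqueₚ.cartesianProduct⁺ (Uniqueₚ.upTo⁺ (suc N)) (Uniqueₚ.upTo⁺ (suc N))
  involutive : InvolutiveOn (≡-dec _≟_ _≟_) rotate (λ ab → weight ab ≡ᵇ N) pairs
  involutive {a , b} _ weight≡N =
    ∈-cartesianProduct⁺ (∈-upTo⁺ (s≤s a′≤N)) (∈-upTo⁺ (s≤s b′≤N)) ,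
    ≡ᵇ-true rotate-weight≡N ,
    rotate-involutive (shape a b)
    where
    rotate-weight≡N : weight (rotate (a , b)) ≡ N
    rotate-weight≡N = trans (rotate-weight (shape a b)) (≡ᵇ-true⇒≡ weight≡N)
    a′≤N : proj₁ (rotate (a , b)) ≤ N
    a′≤N = ≤-trans (a≤triangle[a] _) (≤-trans (m≤m+n _ _) (≤-reflexive rotate-weight≡N))
    b′≤N : proj₂ (rotate (a , b)) ≤ N
    b′≤N = ≤-trans (a≤triangle[a] _) (≤-trans (m≤m*n _ 3) (≤-trans (m≤n+m _ _) (≤-reflexive rotate-weight≡N)))
  residue : ∀ {ab} → weight ab ≡ N → weight ab % 4 ≡ r
  residue weight≡N = trans (cong (_% 4) (trans weight≡N (+-comm (m * 4) r)))
                           (trans ([m+kn]%n≡m%n r m 4) (m<n⇒m%n≡m (≡2∨3⇒<4 r≡2∨3)))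
  fixed-point-free : ∀ {ab} → ab ∈ pairs → (weight ab ≡ᵇ N) ≡ true → rotate ab ≢ ab
  fixed-point-free {a , b} _ weight≡N fixed =
    r≢0,1 r≡2∨3 (subst (λ x → x ≡ 0 ⊎ x ≡ 1) (residue {a , b} (≡ᵇ-true⇒≡ weight≡N)) (rotate-fixed (shape a b) fixed))
    where
    r≢0,1 : ∀ {r} → r ≡ 2 ⊎ r ≡ 3 → ¬ (r ≡ 0 ⊎ r ≡ 1)
    r≢0,1 (inj₁ refl) (inj₁ ())
    r≢0,1 (inj₁ refl) (inj₂ ())
    r≢0,1 (inj₂ refl) (inj₁ ())
    r≢0,1 (inj₂ refl) (inj₂ ())

-- The factorisation O(q) O(q³) = O(q⁴) O(q¹²) · ψ(q) ψ(q³)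

ψ⊛O³≗one : ψ ⊛ (O ⊛ O ⊛ O) ≗ one₂
ψ⊛O³≗one = begin
  ψ ⊛ (O ⊛ O ⊛ O)       ≈⟨ solve 2 (λ p o → p ⊗ ((o ⊗ o) ⊗ o) ⊜ (p ⊗ o) ⊗ (o ⊗ o)) (λ _ → refl) ψ O ⟩
  ψ ⊛ O ⊛ (O ⊛ O)       ≈⟨ ⊛-congʳ (O ⊛ O) (λ i → sym (E⊛E≗ψ⊛O i)) ⟩
  E ⊛ E ⊛ (O ⊛ O)       ≈⟨ solve 2 (λ e o → (e ⊗ e) ⊗ (o ⊗ o) ⊜ (o ⊗ e) ⊗ (o ⊗ e)) (λ _ → refl) E O ⟩
  O ⊛ E ⊛ (O ⊛ E)       ≈⟨ ⊛-cong O⊛E≗one O⊛E≗one ⟩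
  one₂ ⊛ one₂           ≈⟨ ⊛-identityˡ one₂ ⟩
  one₂                  ∎
  where open ≗-Reasoning

-- multiply by ψ O³ = 1 at q and at q³
O⊛O[q³]-factor : O ⊛ dilate 3 O ≗ dilate 4 (O ⊛ dilate 3 O) ⊛ (ψ ⊛ dilate 3 ψ)
O⊛O[q³]-factor = begin
  O ⊛ O₃
    ≈⟨ (λ i → sym (⊛-identityʳ (O ⊛ O₃) i)) ⟩
  O ⊛ O₃ ⊛ one₂
    ≈⟨ ⊛-congˡ (O ⊛ O₃) (λ i → sym (⊛-identityʳ one₂ i)) ⟩
  O ⊛ O₃ ⊛ (one₂ ⊛ one₂)
    ≈⟨ ⊛-congˡ (O ⊛ O₃) (⊛-cong (λ i → sym (ψ⊛O³≗one i)) (λ i → sym (dilate-one 3 i))) ⟩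
  O ⊛ O₃ ⊛ (ψ ⊛ (O ⊛ O ⊛ O) ⊛ dilate 3 one₂)
    ≈⟨ ⊛-congˡ (O ⊛ O₃) (⊛-congˡ (ψ ⊛ (O ⊛ O ⊛ O)) (dilate-cong 3 (λ i → sym (ψ⊛O³≗one i)))) ⟩
  O ⊛ O₃ ⊛ (ψ ⊛ (O ⊛ O ⊛ O) ⊛ dilate 3 (ψ ⊛ (O ⊛ O ⊛ O)))
    ≈⟨ ⊛-congˡ (O ⊛ O₃) (⊛-congˡ (ψ ⊛ (O ⊛ O ⊛ O)) dilate₃) ⟩
  O ⊛ O₃ ⊛ (ψ ⊛ (O ⊛ O ⊛ O) ⊛ (ψ₃ ⊛ (O₃ ⊛ O₃ ⊛ O₃)))
    ≈⟨ solve 4 (λ o o₃ p p₃ → (o ⊗ o₃) ⊗ ((p ⊗ ((o ⊗ o) ⊗ o)) ⊗ (p₃ ⊗ ((o₃ ⊗ o₃) ⊗ o₃)))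
                          ⊜ (((o ⊗ o) ⊗ (o ⊗ o)) ⊗ ((o₃ ⊗ o₃) ⊗ (o₃ ⊗ o₃))) ⊗ (p ⊗ p₃))
             (λ _ → refl) O O₃ ψ ψ₃ ⟩
  O ⊛ O ⊛ (O ⊛ O) ⊛ (O₃ ⊛ O₃ ⊛ (O₃ ⊛ O₃)) ⊛ (ψ ⊛ ψ₃)
    ≈⟨ ⊛-congʳ (ψ ⊛ ψ₃) (⊛-cong (⊛-fourth O) (⊛-fourth O₃)) ⟩
  dilate 4 O ⊛ dilate 4 O₃ ⊛ (ψ ⊛ ψ₃)
    ≈⟨ ⊛-congʳ (ψ ⊛ ψ₃) (λ i → sym (dilate-⊛ 4 O O₃ i)) ⟩
  dilate 4 (O ⊛ O₃) ⊛ (ψ ⊛ ψ₃) ∎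
  where
  open ≗-Reasoning
  O₃ ψ₃ : Series₂
  O₃ = dilate 3 O
  ψ₃ = dilate 3 ψ
  dilate₃ : dilate 3 (ψ ⊛ (O ⊛ O ⊛ O)) ≗ ψ₃ ⊛ (O₃ ⊛ O₃ ⊛ O₃)
  dilate₃ = begin
    dilate 3 (ψ ⊛ (O ⊛ O ⊛ O))              ≈⟨ dilate-⊛ 3 ψ (O ⊛ O ⊛ O) ⟩
    ψ₃ ⊛ dilate 3 (O ⊛ O ⊛ O)               ≈⟨ ⊛-congˡ ψ₃ (dilate-⊛ 3 (O ⊛ O) O) ⟩
    ψ₃ ⊛ (dilate 3 (O ⊛ O) ⊛ O₃)            ≈⟨ ⊛-congˡ ψ₃ (⊛-congʳ O₃ (dilate-⊛ 3 O O)) ⟩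
    ψ₃ ⊛ (O₃ ⊛ O₃ ⊛ O₃)                     ∎

-- Reduction modulo 2

open import Data.Integer using (ℤ; +_; 0ℤ; 1ℤ; _-_)
import Data.Integer as ℤ
import Data.Integer.Properties as ℤ
import Data.Integer.Tactic.RingSolver as ℤSolver
open import Data.Integer.Divisibility using (_∣_)
import Data.Integer.Divisibility.Signed as Signed
open Signed using (divides) renaming (_∣_ to _∣ₛ_)

⟦_⟧ : Bool → ℤ
⟦ true  ⟧ = 1ℤ
⟦ false ⟧ = 0ℤ

infix 4 _≡₂_

_≡₂_ : ℤ → Bool → Set
x ≡₂ b = + 2 ∣ₛ x - ⟦ b ⟧

≡₂-sub : ∀ {x y a b} → x ≡₂ a → y ≡₂ b → x - y ≡₂ a xor b
≡₂-sub {x} {y} {a} {b} x≡a y≡b =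
  subst (+ 2 ∣ₛ_) (regroup x y ⟦ a ⟧ ⟦ b ⟧ ⟦ a xor b ⟧) (Signed.∣m∣n⇒∣m+n (Signed.∣m∣n⇒∣m-n x≡a y≡b) (carry a b))
  where
  regroup : ∀ x y a b c → (x - a) - (y - b) ℤ.+ ((a - b) - c) ≡ (x - y) - c
  regroup = ℤSolver.solve-∀
  carry : ∀ a b → + 2 ∣ₛ (⟦ a ⟧ - ⟦ b ⟧) - ⟦ a xor b ⟧
  carry true  true  = divides 0ℤ refl
  carry true  false = divides 0ℤ refl
  carry false true  = divides (ℤ.- 1ℤ) refl
  carry false false = divides 0ℤ refl

prodFactors≡₂prod₂ : ∀ ms i → prodFactors ms i ≡₂ prod₂ ms i
prodFactors≡₂prod₂ []       zero    = divides 0ℤ refl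
prodFactors≡₂prod₂ []       (suc i) = divides 0ℤ refl
prodFactors≡₂prod₂ (m ∷ ms) i = step (m ≤ᵇ i)
  where
  step : ∀ c → prodFactors ms i - (if c then prodFactors ms (i ∸ m) else 0ℤ) ≡₂
               prod₂ ms i xor (c ∧ prod₂ ms (i ∸ m))
  step true  = ≡₂-sub {prodFactors ms i} {prodFactors ms (i ∸ m)} {prod₂ ms i} {prod₂ ms (i ∸ m)}
                    (prodFactors≡₂prod₂ ms i) (prodFactors≡₂prod₂ ms (i ∸ m))
  step false = ≡₂-sub {prodFactors ms i} {0ℤ} {prod₂ ms i} {false} (prodFactors≡₂prod₂ ms i) (divides 0ℤ refl)

≡₂false⇒2∣ : ∀ {x} → x ≡₂ false → + 2 ∣ x
≡₂false⇒2∣ {x} 2∣x-0 = Signed.∣⇒∣ᵤ (subst (+ 2 ∣ₛ_) (ℤ.+-identityʳ x) 2∣x-0)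

A≡₂O⊛O[qᵏ] : ∀ k .{{_ : NonZero k}} N → A k N ≡₂ (O ⊛ dilate k O) N
A≡₂O⊛O[qᵏ] k N = subst (A k N ≡₂_) (begin
  prod₂ (odds N ++ map (k *_) (odds N)) N              ≡⟨ prod₂-++ (odds N) _ N ⟩
  (prod₂ (odds N) ⊛ prod₂ (map (k *_) (odds N))) N
    ≡⟨ ⊛-congˡ (prod₂ (odds N)) (λ i → cong (λ ms → prod₂ ms i) (map-cong (*-comm k) (odds N))) N ⟩
  (prod₂ (odds N) ⊛ prod₂ (map (_* k) (odds N))) N     ≡⟨ ⊛-congˡ (prod₂ (odds N)) (λ i → sym (dilate-prod₂ k (odds N) i)) N ⟩
  (prod₂ (odds N) ⊛ dilate k (prod₂ (odds N))) N
    ≡⟨ ⊛-cong-≈ (≈-sym (limit-≈ odds-growing N)) (dilate-cong-≈ k (≈-sym (limit-≈ odds-growing N))) N ≤-refl ⟩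
  (O ⊛ dilate k O) N                                   ∎)
  (prodFactors≡₂prod₂ (odds N ++ map (k *_) (odds N)) N)
  where open ≡-Reasoning

theorem1p6 : ∀ (n : ℕ) → (+ 2 ∣ A 3 (4 * n + 2)) × (+ 2 ∣ A 3 (4 * n + 3))
theorem1p6 n = A₃-even (inj₁ refl) , A₃-even (inj₂ refl)
  where
  A₃-even : ∀ {r} → r ≡ 2 ⊎ r ≡ 3 → + 2 ∣ A 3 (4 * n + r)
  A₃-even {r} r≡2∨3 = ≡₂false⇒2∣ {A 3 (4 * n + r)} (subst (A 3 (4 * n + r) ≡₂_) vanishes (A≡₂O⊛O[qᵏ] 3 (4 * n + r)))
    where
    open ≡-Reasoning
    vanishes : (O ⊛ dilate 3 O) (4 * n + r) ≡ false
    vanishes = begin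
      (O ⊛ dilate 3 O) (4 * n + r)                                ≡⟨ cong (λ m → (O ⊛ dilate 3 O) (m + r)) (*-comm 4 n) ⟩
      (O ⊛ dilate 3 O) (n * 4 + r)                                ≡⟨ O⊛O[q³]-factor (n * 4 + r) ⟩
      (dilate 4 (O ⊛ dilate 3 O) ⊛ (ψ ⊛ dilate 3 ψ)) (n * 4 + r)
        ≡⟨ dilate-⊛-residue 4 (O ⊛ dilate 3 O) (ψ ⊛ dilate 3 ψ) r (≡2∨3⇒<4 r≡2∨3)
                            (λ j → ψ⊛ψ[q³]-vanishes j r r≡2∨3) n ⟩
      false                                                       ∎
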